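{- For all rooks $r,u\in R_n$, one has $\pi_r\le_{\mathcal{R}}\pi_u$ in $R_n^0$ if and only if $r\le_I u$.
   Context: Rooks of size $n$ are words $r=r_1\dots r_n$ over $\{0,\dots,n\}$ with pairwise distinct nonzero letters; $R_n$ is their set and $1_n=12\cdots n$. $R_n^0$ is the monoid presented by generators $\pi_0,\dots,\pi_{n-1}$ and relations $\pi_i^2=\pi_i$, $\pi_i\pi_{i+1}\pi_i=\pi_{i+1}\pi_i\pi_{i+1}$ ($1\le i\le n-2$), $\pi_1\pi_0\pi_1\pi_0=\pi_0\pi_1\pi_0=\pi_0\pi_1\pi_0\pi_1$, $\pi_i\pi_j=\pi_j\pi_i$ ($|i-j|\ge2$). It acts on the right on $R_n$ by $r\cdot\pi_0=0r_2\cdots r_n$ and, for $k\ge1$, $r\cdot\pi_k$ exchanges $r_k,r_{k+1}$ if $r_k<r_{k+1}$ and fixes $r$ otherwise; for each $r\in R_n$, $\pi_r$ denotes the unique element of $R_n^0$ with $1_n\cdot\pi_r=r$. In a monoid $M$, $x\le_{\mathcal{R}}y$ means $xM\subseteq yM$. For a rook $r$: $\mathrm{supp}(r)$ is its set of nonzero letters, $\mathrm{Inv}(r)=\{(r_i,r_j): i<j,\ r_i>r_j>0\}$, and for $\ell\in\mathrm{supp}(r)$, $Z_r(\ell)$ is the number of zeros after $\ell$ in $r$. Define $r\le_I u$ iff (a) $\mathrm{supp}(r)\subseteq\mathrm{supp}(u)$, (b) $\{(b,a)\in\mathrm{Inv}(u): b\in\mathrm{supp}(r)\}\subseteq\mathrm{Inv}(r)$,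 and (c) $Z_u(\ell)\le Z_r(\ell)$ for all $\ell\in\mathrm{supp}(r)$. -}

module Defs where

open import Data.Nat using (ℕ; zero; suc; _≤_; _<_; _<ᵇ_; _≡ᵇ_)
open import Data.Bool using (Bool; true; false; if_then_else_)
open import Data.Fin using (Fin; toℕ)
open import Data.List using (List; []; _∷_; _++_; length; upTo; map; foldl)
open import Data.List.Relation.Unary.All using (All)
open import Data.List.Membership.Propositional using (_∈_; _∉_)
open import Data.Product using (_×_; ∃; ∃₂)
open import Relation.Binary.PropositionalEquality using (_≡_; _≢_)

IsRook : ℕ → List ℕ → Set
IsRook n r =
  length r ≡ n
  × All (λ x → x ≤ n) r
  × (∀ (xs ys : List ℕ) (ℓ : ℕ) → r ≡ xs ++ ℓ ∷ ys → ℓ ≢ 0 → ℓ ∉ ys)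

one : ℕ → List ℕ
one n = map suc (upTo n)

act0 : List ℕ → List ℕ
act0 []       = []
act0 (_ ∷ xs) = 0 ∷ xs

-- actSwap k r, for k ≥ 1: exchange r_k, r_{k+1} (1-indexed) if r_k < r_{k+1}
actSwap : ℕ → List ℕ → List ℕ
actSwap zero          xs           = xs
actSwap (suc zero)    (a ∷ b ∷ xs) = if a <ᵇ b then b ∷ a ∷ xs else a ∷ b ∷ xs
actSwap (suc zero)    xs           = xs
actSwap (suc (suc k)) []           = []
actSwap (suc (suc k)) (x ∷ xs)     = x ∷ actSwap (suc k) xs

actGen : ∀ {n} → List ℕ → Fin n → List ℕ
actGen r k with toℕ k
... | zero  = act0 r
... | suc j = actSwap (suc j) r

act : ∀ {n} → List ℕ → List (Fin n) → List ℕ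
act r w = foldl actGen r w

-- The monoid R_n^0 presented by generators π_0,…,π_{n-1}: elements are
-- words in List (Fin n) modulo the congruence generated by the relations.

data BaseRel (n : ℕ) : List (Fin n) → List (Fin n) → Set where
  idem  : (i : Fin n) → BaseRel n (i ∷ i ∷ []) (i ∷ [])
  braid : (i j : Fin n) → 1 ≤ toℕ i → toℕ j ≡ suc (toℕ i) →
          BaseRel n (i ∷ j ∷ i ∷ []) (j ∷ i ∷ j ∷ [])
  rel0a : (z o : Fin n) → toℕ z ≡ 0 → toℕ o ≡ 1 →
          BaseRel n (o ∷ z ∷ o ∷ z ∷ []) (z ∷ o ∷ z ∷ [])
  rel0b : (z o : Fin n) → toℕ z ≡ 0 → toℕ o ≡ 1 →
          BaseRel n (z ∷ o ∷ z ∷ o ∷ []) (z ∷ o ∷ z ∷ [])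
  comm  : (i j : Fin n) → suc (toℕ i) < toℕ j →
          BaseRel n (i ∷ j ∷ []) (j ∷ i ∷ [])

data Cong (n : ℕ) : List (Fin n) → List (Fin n) → Set where
  c-base  : ∀ {u v} (x y : List (Fin n)) →
            BaseRel n u v → Cong n (x ++ u ++ y) (x ++ v ++ y)
  c-refl  : ∀ {u} → Cong n u u
  c-sym   : ∀ {u v} → Cong n u v → Cong n v u
  c-trans : ∀ {u v w} → Cong n u v → Cong n v w → Cong n u w

-- Green's R-preorder in R_n^0: x ≤_R y iff xM ⊆ yM iff x = y m for some m
LeqR : (n : ℕ) → List (Fin n) → List (Fin n) → Set
LeqR n x y = ∃ λ (m : List (Fin n)) → Cong n x (y ++ m)

InSupp : ℕ → List ℕ → Set
InSupp ℓ r = ℓ ≢ 0 × ℓ ∈ r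

Inv : List ℕ → ℕ → ℕ → Set
Inv r b a = 0 < a × a < b × ∃₂ λ xs ys → r ≡ xs ++ b ∷ ys × a ∈ ys

count0 : List ℕ → ℕ
count0 []            = 0
count0 (zero ∷ xs)   = suc (count0 xs)
count0 (suc _ ∷ xs)  = count0 xs

Z : List ℕ → ℕ → ℕ
Z []       ℓ = 0
Z (x ∷ xs) ℓ = if x ≡ᵇ ℓ then count0 xs else Z xs ℓ

_≤I_ : List ℕ → List ℕ → Set
r ≤I u =
  (∀ ℓ → InSupp ℓ r → InSupp ℓ u)
  × (∀ b a → Inv u b a → InSupp b r → Inv r b a)
  × (∀ ℓ → InSupp ℓ r → Z u ℓ ≤ Z r ℓ)

-- The action r ↦ r · π of R_n^0 on rooks is faithful: by induction on n,
-- every word π is congruent to a canonical word determined by the rook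
-- 1_n · π, which first builds the rook on the letters 1 … n−1 and then inserts
-- n (or a zero) by a run of consecutive generators. Hence π_r ≤_R π_u iff
-- u · w = r for some word w. Each generator moves a rook down in ≤_I, which
-- gives one direction. Conversely, if r ≤_I u, the last letter of r is
-- produced at the end of u by a run of generators -- moving the same letter,
-- the last zero, or a letter of u missing from r (erased by π_0) -- and the
-- conditions of ≤_I say exactly that this run does not disturb the rest, so
-- one recurses on the first n−1 letters.
module Submission where

open import Defs
open import Data.Nat using (ℕ; zero; suc; _+_; _∸_; _≤_; _<_; _<ᵇ_; _≡ᵇ_; _⊓_; _⊔_; s≤s; s≤s⁻¹; z≤n)
open import Data.Nat.Properties
open import Data.Bool using (Bool; T; true; false; if_then_else_)
open import Data.Fin using (Fin; toℕ) renaming (zero to fzero; suc to fsuc)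
open import Data.Fin.Properties using (toℕ<n)
open import Data.List using (List; []; _∷_; _++_; _∷ʳ_; length; map; foldl; upTo; applyUpTo)
open import Data.List.Reverse using (reverseView; []; _∶_∶ʳ_)
open import Data.List.Properties using (++-assoc; ++-identityʳ; applyUpTo-∷ʳ; foldl-++; length-++; length-applyUpTo; length-map; map-++)
open import Data.List.Relation.Unary.All as All using (All; []; _∷_; tabulate)
open import Data.List.Relation.Unary.All.Properties using (++⁺; map⁺)
open import Data.List.Relation.Unary.Any using (here; there)
open import Data.List.Membership.Propositional using (_∈_; _∉_)
open import Data.List.Membership.Propositional.Properties using (∈-++⁺ʳ; ∈-++⁺ˡ; ∈-++⁻)
open import Data.List.Membership.DecPropositional _≟_ using (_∈?_)
open import Data.Empty using (⊥; ⊥-elim)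
open import Data.Unit using (tt)
open import Data.Sum using (_⊎_; inj₁; inj₂)
open import Data.Product using (_,_; _×_; proj₁; proj₂; ∃; ∃₂)
open import Relation.Nullary using (¬_; yes; no)
open import Function.Base using (id; _∘_)
open import Relation.Binary.Definitions using (tri<; tri≈; tri>)
open import Relation.Binary.PropositionalEquality
open import Function.Bundles using (_⇔_; mk⇔)
open import Relation.Binary.Bundles using (Setoid)
open import Level using (0ℓ)
import Relation.Binary.Reasoning.Setoid as SetoidReasoning

act₁ : List ℕ → ℕ → List ℕ
act₁ r zero    = act0 r
act₁ r (suc j) = actSwap (suc j) r

actℕ : List ℕ → List ℕ → List ℕ
actℕ r w = foldl act₁ r w

actGen≡act₁ : ∀ {n} (r : List ℕ) (k : Fin n) → actGen r k ≡ act₁ r (toℕ k)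
actGen≡act₁ r k with toℕ k
... | zero  = refl
... | suc j = refl

act≡actℕ : ∀ {n} (r : List ℕ) (w : List (Fin n)) → act r w ≡ actℕ r (map toℕ w)
act≡actℕ r []      = refl
act≡actℕ r (k ∷ w) rewrite actGen≡act₁ r k = act≡actℕ (act₁ r (toℕ k)) w

actℕ-++ : ∀ r u v → actℕ r (u ++ v) ≡ actℕ (actℕ r u) v
actℕ-++ = foldl-++ act₁

actSwap₁-< : ∀ {a b} (xs : List ℕ) → a < b → actSwap 1 (a ∷ b ∷ xs) ≡ b ∷ a ∷ xs
actSwap₁-< {a} {b} xs a<b with a <ᵇ b in eq
... | true  = refl
... | false = ⊥-elim (subst T eq (<⇒<ᵇ a<b))

actSwap₁-≥ : ∀ {a b} (xs : List ℕ) → b ≤ a → actSwap 1 (a ∷ b ∷ xs) ≡ a ∷ b ∷ xs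
actSwap₁-≥ {a} {b} xs b≤a with a <ᵇ b in eq
... | false = refl
... | true  = ⊥-elim (<⇒≱ (<ᵇ⇒< a b (subst T (sym eq) tt)) b≤a)

actSwap₁-⊔⊓ : ∀ a b (xs : List ℕ) → actSwap 1 (a ∷ b ∷ xs) ≡ a ⊔ b ∷ a ⊓ b ∷ xs
actSwap₁-⊔⊓ a b xs with a <? b
... | yes a<b = trans (actSwap₁-< xs a<b)
  (cong₂ (λ x y → x ∷ y ∷ xs) (sym (m≤n⇒m⊔n≡n (<⇒≤ a<b))) (sym (m≤n⇒m⊓n≡m (<⇒≤ a<b))))
... | no a≮b = trans (actSwap₁-≥ xs (≮⇒≥ a≮b))
  (cong₂ (λ x y → x ∷ y ∷ xs) (sym (m≥n⇒m⊔n≡m (≮⇒≥ a≮b))) (sym (m≥n⇒m⊓n≡n (≮⇒≥ a≮b))))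

act0-idem : ∀ r → act0 (act0 r) ≡ act0 r
act0-idem []      = refl
act0-idem (x ∷ r) = refl

actSwap-idem : ∀ i r → actSwap (suc i) (actSwap (suc i) r) ≡ actSwap (suc i) r
actSwap-idem zero    []          = refl
actSwap-idem zero    (x ∷ [])    = refl
actSwap-idem zero    (a ∷ b ∷ r) rewrite actSwap₁-⊔⊓ a b r = actSwap₁-≥ r (m⊓n≤m⊔n a b)
actSwap-idem (suc i) []          = refl
actSwap-idem (suc i) (x ∷ r)     = cong (x ∷_) (actSwap-idem i r)

act₁-idem : ∀ k r → act₁ (act₁ r k) k ≡ act₁ r k
act₁-idem zero    r = act0-idem r
act₁-idem (suc i) r = actSwap-idem i r

actSwap-comm : ∀ i j r → suc (suc i) < suc j →
  actSwap (suc j) (actSwap (suc i) r) ≡ actSwap (suc i) (actSwap (suc j) r)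
actSwap-comm zero    (suc (suc j)) []          _ = refl
actSwap-comm zero    (suc (suc j)) (x ∷ [])    _ = refl
actSwap-comm zero    (suc (suc j)) (a ∷ b ∷ r) _
  rewrite actSwap₁-⊔⊓ a b r | actSwap₁-⊔⊓ a b (actSwap (suc j) r) = refl
actSwap-comm (suc i) (suc j)       []          _ = refl
actSwap-comm (suc i) (suc j)       (x ∷ r)     (s≤s i<j) = cong (x ∷_) (actSwap-comm i j r i<j)
actSwap-comm zero    zero          r (s≤s ())
actSwap-comm zero    (suc zero)    r (s≤s (s≤s ()))
actSwap-comm (suc i) zero          r (s≤s ())

act₁-comm : ∀ i j r → suc i < j → act₁ (act₁ r i) j ≡ act₁ (act₁ r j) i
act₁-comm zero    (suc (suc j)) []      _ = refl
act₁-comm zero    (suc (suc j)) (x ∷ r) _ = refl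
act₁-comm (suc i) (suc j)       r       p = actSwap-comm i j r p
act₁-comm zero    (suc zero)    r       (s≤s ())

-- Both sides of the braid relation sort three letters by compare-exchanges;
-- these are the three outputs, compared.
sort₃-max : ∀ a b c → (a ⊔ b) ⊔ ((a ⊓ b) ⊔ c) ≡ a ⊔ (b ⊔ c)
sort₃-max zero    b       c       = refl
sort₃-max (suc a) zero    c       = refl
sort₃-max (suc a) (suc b) zero    = cong suc (m≥n⇒m⊔n≡m (m⊓n≤m⊔n a b))
sort₃-max (suc a) (suc b) (suc c) = cong suc (sort₃-max a b c)

sort₃-median : ∀ a b c → (a ⊔ b) ⊓ ((a ⊓ b) ⊔ c) ≡ (a ⊓ (b ⊔ c)) ⊔ (b ⊓ c)
sort₃-median zero    b       c       = refl
sort₃-median (suc a) zero    c       = sym (⊔-identityʳ _)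
sort₃-median (suc a) (suc b) zero    = cong suc (m≥n⇒m⊓n≡n (m⊓n≤m⊔n a b))
sort₃-median (suc a) (suc b) (suc c) = cong suc (sort₃-median a b c)

sort₃-min : ∀ a b c → (a ⊓ b) ⊓ c ≡ (a ⊓ (b ⊔ c)) ⊓ (b ⊓ c)
sort₃-min zero    b       c       = refl
sort₃-min (suc a) zero    c       = sym (⊓-zeroʳ _)
sort₃-min (suc a) (suc b) zero    = trans (⊓-zeroʳ (suc (a ⊓ b))) (sym (⊓-zeroʳ (suc a ⊓ suc b)))
sort₃-min (suc a) (suc b) (suc c) = cong suc (sort₃-min a b c)

actSwap-braid₁ : ∀ r → actSwap 1 (actSwap 2 (actSwap 1 r)) ≡ actSwap 2 (actSwap 1 (actSwap 2 r))
actSwap-braid₁ []              = refl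
actSwap-braid₁ (a ∷ [])        = refl
actSwap-braid₁ (a ∷ b ∷ [])
  rewrite actSwap₁-⊔⊓ a b [] = actSwap₁-≥ [] (m⊓n≤m⊔n a b)
actSwap-braid₁ (a ∷ b ∷ c ∷ xs) = begin
    actSwap 1 (actSwap 2 (actSwap 1 (a ∷ b ∷ c ∷ xs)))
  ≡⟨ cong (λ z → actSwap 1 (actSwap 2 z)) (actSwap₁-⊔⊓ a b (c ∷ xs)) ⟩
    actSwap 1 (a ⊔ b ∷ actSwap 1 (a ⊓ b ∷ c ∷ xs))
  ≡⟨ cong (λ z → actSwap 1 (a ⊔ b ∷ z)) (actSwap₁-⊔⊓ (a ⊓ b) c xs) ⟩
    actSwap 1 (a ⊔ b ∷ (a ⊓ b) ⊔ c ∷ (a ⊓ b) ⊓ c ∷ xs)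
  ≡⟨ actSwap₁-⊔⊓ _ _ _ ⟩
    (a ⊔ b) ⊔ ((a ⊓ b) ⊔ c) ∷ (a ⊔ b) ⊓ ((a ⊓ b) ⊔ c) ∷ (a ⊓ b) ⊓ c ∷ xs
  ≡⟨ cong₂ _∷_ (sort₃-max a b c) (cong₂ (λ y z → y ∷ z ∷ xs) (sort₃-median a b c) (sort₃-min a b c)) ⟩
    a ⊔ (b ⊔ c) ∷ (a ⊓ (b ⊔ c)) ⊔ (b ⊓ c) ∷ (a ⊓ (b ⊔ c)) ⊓ (b ⊓ c) ∷ xs
  ≡⟨ cong (a ⊔ (b ⊔ c) ∷_) (actSwap₁-⊔⊓ _ _ _) ⟨
    actSwap 2 (a ⊔ (b ⊔ c) ∷ a ⊓ (b ⊔ c) ∷ b ⊓ c ∷ xs)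
  ≡⟨ cong (actSwap 2) (actSwap₁-⊔⊓ a (b ⊔ c) (b ⊓ c ∷ xs)) ⟨
    actSwap 2 (actSwap 1 (a ∷ b ⊔ c ∷ b ⊓ c ∷ xs))
  ≡⟨ cong (λ z → actSwap 2 (actSwap 1 (a ∷ z))) (actSwap₁-⊔⊓ b c xs) ⟨
    actSwap 2 (actSwap 1 (actSwap 2 (a ∷ b ∷ c ∷ xs)))
  ∎
  where open ≡-Reasoning

actSwap-braid : ∀ i r → actSwap (suc i) (actSwap (2 + i) (actSwap (suc i) r))
                      ≡ actSwap (2 + i) (actSwap (suc i) (actSwap (2 + i) r))
actSwap-braid zero    r       = actSwap-braid₁ r
actSwap-braid (suc i) []      = refl
actSwap-braid (suc i) (x ∷ r) = cong (x ∷_) (actSwap-braid i r)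

act0-rel0a : ∀ r → act0 (actSwap 1 (act0 (actSwap 1 r))) ≡ act0 (actSwap 1 (act0 r))
act0-rel0a []           = refl
act0-rel0a (a ∷ [])     = refl
act0-rel0a (a ∷ b ∷ xs)
  rewrite actSwap₁-⊔⊓ a b xs | actSwap₁-⊔⊓ 0 (a ⊓ b) xs | actSwap₁-⊔⊓ 0 b xs = refl

act0-rel0b : ∀ r → actSwap 1 (act0 (actSwap 1 (act0 r))) ≡ act0 (actSwap 1 (act0 r))
act0-rel0b []           = refl
act0-rel0b (a ∷ [])     = refl
act0-rel0b (a ∷ b ∷ xs) rewrite actSwap₁-⊔⊓ 0 b xs = refl

act-respects-BaseRel : ∀ {n} r {u v : List (Fin n)} → BaseRel n u v → act r u ≡ act r v
act-respects-BaseRel r (idem i)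
  rewrite act≡actℕ r (i ∷ i ∷ []) | act≡actℕ r (i ∷ []) = act₁-idem (toℕ i) r
act-respects-BaseRel r (braid i j 1≤i j≡1+i)
  rewrite act≡actℕ r (i ∷ j ∷ i ∷ []) | act≡actℕ r (j ∷ i ∷ j ∷ []) | j≡1+i = braidℕ (toℕ i) 1≤i
  where
  braidℕ : ∀ t → 1 ≤ t → act₁ (act₁ (act₁ r t) (suc t)) t ≡ act₁ (act₁ (act₁ r (suc t)) t) (suc t)
  braidℕ (suc t) _ = actSwap-braid t r
act-respects-BaseRel r (rel0a z o z≡0 o≡1)
  rewrite act≡actℕ r (o ∷ z ∷ o ∷ z ∷ []) | act≡actℕ r (z ∷ o ∷ z ∷ []) | z≡0 | o≡1 = act0-rel0a r
act-respects-BaseRel r (rel0b z o z≡0 o≡1)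
  rewrite act≡actℕ r (z ∷ o ∷ z ∷ o ∷ []) | act≡actℕ r (z ∷ o ∷ z ∷ []) | z≡0 | o≡1 = act0-rel0b r
act-respects-BaseRel r (comm i j i+1<j)
  rewrite act≡actℕ r (i ∷ j ∷ []) | act≡actℕ r (j ∷ i ∷ []) = act₁-comm (toℕ i) (toℕ j) r i+1<j

act-++ : ∀ {n} r (u v : List (Fin n)) → act r (u ++ v) ≡ act (act r u) v
act-++ r u v = foldl-++ actGen r u v

act-respects-Cong : ∀ {n} r {u v : List (Fin n)} → Cong n u v → act r u ≡ act r v
act-respects-Cong r (c-base {u} {v} x y rel) = begin
    act r (x ++ u ++ y)    ≡⟨ act-++ r x (u ++ y) ⟩
    act (act r x) (u ++ y) ≡⟨ act-++ (act r x) u y ⟩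
    act (act (act r x) u) y ≡⟨ cong (λ s → act s y) (act-respects-BaseRel (act r x) rel) ⟩
    act (act (act r x) v) y ≡⟨ act-++ (act r x) v y ⟨
    act (act r x) (v ++ y) ≡⟨ act-++ r x (v ++ y) ⟨
    act r (x ++ v ++ y)    ∎
  where open ≡-Reasoning
act-respects-Cong r c-refl          = refl
act-respects-Cong r (c-sym c)       = sym (act-respects-Cong r c)
act-respects-Cong r (c-trans c₁ c₂) = trans (act-respects-Cong r c₁) (act-respects-Cong r c₂)

-- The relations of BaseRel, indexed by ℕ so that runs π_a ⋯ π_b are plain lists.
data Relℕ (N : ℕ) : List ℕ → List ℕ → Set where
  idem  : ∀ i → i < N → Relℕ N (i ∷ i ∷ []) (i ∷ [])
  braid : ∀ i → suc (suc i) < N →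
          Relℕ N (suc i ∷ suc (suc i) ∷ suc i ∷ []) (suc (suc i) ∷ suc i ∷ suc (suc i) ∷ [])
  rel0a : 1 < N → Relℕ N (1 ∷ 0 ∷ 1 ∷ 0 ∷ []) (0 ∷ 1 ∷ 0 ∷ [])
  rel0b : 1 < N → Relℕ N (0 ∷ 1 ∷ 0 ∷ 1 ∷ []) (0 ∷ 1 ∷ 0 ∷ [])
  comm  : ∀ i j → suc i < j → j < N → Relℕ N (i ∷ j ∷ []) (j ∷ i ∷ [])

data Congℕ (N : ℕ) : List ℕ → List ℕ → Set where
  c-base  : ∀ x y {u v} → Relℕ N u v → Congℕ N (x ++ u ++ y) (x ++ v ++ y)
  c-refl  : ∀ {u} → Congℕ N u u
  c-sym   : ∀ {u v} → Congℕ N u v → Congℕ N v u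
  c-trans : ∀ {u v w} → Congℕ N u v → Congℕ N v w → Congℕ N u w

Congℕ-setoid : ℕ → Setoid 0ℓ 0ℓ
Congℕ-setoid N = record
  { Carrier       = List ℕ
  ; _≈_           = Congℕ N
  ; isEquivalence = record { refl = c-refl ; sym = c-sym ; trans = c-trans }
  }

module ≈-Reasoning (N : ℕ) = SetoidReasoning (Congℕ-setoid N)

≡⇒Congℕ : ∀ {N u v} → u ≡ v → Congℕ N u v
≡⇒Congℕ refl = c-refl

Relℕ-weaken : ∀ {N u v} → Relℕ N u v → Relℕ (suc N) u v
Relℕ-weaken (idem i p)     = idem i (m≤n⇒m≤1+n p)
Relℕ-weaken (braid i p)    = braid i (m≤n⇒m≤1+n p)
Relℕ-weaken (rel0a p)      = rel0a (m≤n⇒m≤1+n p)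
Relℕ-weaken (rel0b p)      = rel0b (m≤n⇒m≤1+n p)
Relℕ-weaken (comm i j p q) = comm i j p (m≤n⇒m≤1+n q)

Congℕ-weaken : ∀ {N u v} → Congℕ N u v → Congℕ (suc N) u v
Congℕ-weaken (c-base x y r)  = c-base x y (Relℕ-weaken r)
Congℕ-weaken c-refl          = c-refl
Congℕ-weaken (c-sym c)       = c-sym (Congℕ-weaken c)
Congℕ-weaken (c-trans c₁ c₂) = c-trans (Congℕ-weaken c₁) (Congℕ-weaken c₂)

Congℕ-in-context : ∀ {N u v} x y → Congℕ N u v → Congℕ N (x ++ u ++ y) (x ++ v ++ y)
Congℕ-in-context {N} x y (c-base x′ y′ {u} {v} r) =
  subst₂ (Congℕ N) (reassoc u) (reassoc v) (c-base (x ++ x′) (y′ ++ y) r)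
  where
  reassoc : ∀ u → (x ++ x′) ++ u ++ y′ ++ y ≡ x ++ (x′ ++ u ++ y′) ++ y
  reassoc u = begin
    (x ++ x′) ++ u ++ y′ ++ y   ≡⟨ ++-assoc x x′ (u ++ y′ ++ y) ⟩
    x ++ x′ ++ u ++ y′ ++ y     ≡⟨ cong (λ t → x ++ x′ ++ t) (++-assoc u y′ y) ⟨
    x ++ x′ ++ (u ++ y′) ++ y   ≡⟨ cong (x ++_) (++-assoc x′ (u ++ y′) y) ⟨
    x ++ (x′ ++ u ++ y′) ++ y   ∎
    where open ≡-Reasoning
Congℕ-in-context x y c-refl          = c-refl
Congℕ-in-context x y (c-sym c)       = c-sym (Congℕ-in-context x y c)
Congℕ-in-context x y (c-trans c₁ c₂) = c-trans (Congℕ-in-context x y c₁) (Congℕ-in-context x y c₂)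

Congℕ-append : ∀ {N u v} y → Congℕ N u v → Congℕ N (u ++ y) (v ++ y)
Congℕ-append y = Congℕ-in-context [] y

Congℕ-prepend : ∀ {N u v} x → Congℕ N u v → Congℕ N (x ++ u) (x ++ v)
Congℕ-prepend {N} {u} {v} x c =
  subst₂ (Congℕ N) (cong (x ++_) (++-identityʳ u)) (cong (x ++_) (++-identityʳ v)) (Congℕ-in-context x [] c)

-- clamp n i = i for i ≤ n.
clamp : (n : ℕ) → ℕ → Fin (suc n)
clamp n       zero    = fzero
clamp zero    (suc i) = fzero
clamp (suc n) (suc i) = fsuc (clamp n i)

toℕ-clamp : ∀ n i → i ≤ n → toℕ (clamp n i) ≡ i
toℕ-clamp n       zero    _         = refl
toℕ-clamp (suc n) (suc i) (s≤s i≤n) = cong suc (toℕ-clamp n i i≤n)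

clamp-toℕ : ∀ n (k : Fin (suc n)) → clamp n (toℕ k) ≡ k
clamp-toℕ n       fzero    = refl
clamp-toℕ (suc n) (fsuc k) = cong fsuc (clamp-toℕ n k)

map-clamp-toℕ : ∀ n (w : List (Fin (suc n))) → map (clamp n) (map toℕ w) ≡ w
map-clamp-toℕ n []      = refl
map-clamp-toℕ n (k ∷ w) = cong₂ _∷_ (clamp-toℕ n k) (map-clamp-toℕ n w)

Relℕ⇒BaseRel : ∀ {n u v} → Relℕ (suc n) u v → BaseRel (suc n) (map (clamp n) u) (map (clamp n) v)
Relℕ⇒BaseRel {n} (idem i _) = idem (clamp n i)
Relℕ⇒BaseRel {n} (braid i (s≤s i+2≤n)) =
  braid (clamp n (suc i)) (clamp n (suc (suc i)))
    (subst (1 ≤_) (sym i+1≡) (s≤s z≤n))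
    (trans (toℕ-clamp n (suc (suc i)) i+2≤n) (cong suc (sym i+1≡)))
  where
  i+1≡ : toℕ (clamp n (suc i)) ≡ suc i
  i+1≡ = toℕ-clamp n (suc i) (<⇒≤ i+2≤n)
Relℕ⇒BaseRel {n} (rel0a (s≤s 1≤n)) = rel0a (clamp n 0) (clamp n 1) refl (toℕ-clamp n 1 1≤n)
Relℕ⇒BaseRel {n} (rel0b (s≤s 1≤n)) = rel0b (clamp n 0) (clamp n 1) refl (toℕ-clamp n 1 1≤n)
Relℕ⇒BaseRel {n} (comm i j i+1<j (s≤s j≤n)) =
  comm (clamp n i) (clamp n j)
    (subst₂ (λ a b → suc a < b) (sym (toℕ-clamp n i i≤n)) (sym (toℕ-clamp n j j≤n)) i+1<j)
  where
  i≤n : i ≤ n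
  i≤n = ≤-trans (n≤1+n i) (≤-trans (<⇒≤ i+1<j) j≤n)

Congℕ⇒Cong : ∀ {n u v} → Congℕ (suc n) u v → Cong (suc n) (map (clamp n) u) (map (clamp n) v)
Congℕ⇒Cong {n} (c-base x y {u} {v} r) =
  subst₂ (Cong (suc n)) (sym (map-split u)) (sym (map-split v))
    (c-base (map (clamp n) x) (map (clamp n) y) (Relℕ⇒BaseRel r))
  where
  map-split : ∀ u → map (clamp n) (x ++ u ++ y) ≡ map (clamp n) x ++ map (clamp n) u ++ map (clamp n) y
  map-split u = trans (map-++ (clamp n) x (u ++ y)) (cong (map (clamp n) x ++_) (map-++ (clamp n) u y))
Congℕ⇒Cong c-refl          = c-refl
Congℕ⇒Cong (c-sym c)       = c-sym (Congℕ⇒Cong c)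
Congℕ⇒Cong (c-trans c₁ c₂) = c-trans (Congℕ⇒Cong c₁) (Congℕ⇒Cong c₂)

act₁-++ˡ : ∀ k xs zs → k < length xs → act₁ (xs ++ zs) k ≡ act₁ xs k ++ zs
act₁-++ˡ zero          (x ∷ xs)     zs _ = refl
act₁-++ˡ (suc zero)    (a ∷ b ∷ xs) zs _
  rewrite actSwap₁-⊔⊓ a b (xs ++ zs) | actSwap₁-⊔⊓ a b xs = refl
act₁-++ˡ (suc (suc k)) (x ∷ xs)     zs (s≤s k<) = cong (x ∷_) (act₁-++ˡ (suc k) xs zs k<)
act₁-++ˡ (suc zero)    (a ∷ [])     zs (s≤s ())

act₁-++ʳ : ∀ xs ys j → act₁ (xs ++ ys) (length xs + suc j) ≡ xs ++ act₁ ys (suc j)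
act₁-++ʳ []       ys j = refl
act₁-++ʳ (x ∷ xs) ys j = begin
  act₁ (x ∷ xs ++ ys) (suc (length xs + suc j))   ≡⟨ cong (act₁ (x ∷ xs ++ ys) ∘ suc) (+-suc (length xs) j) ⟩
  x ∷ act₁ (xs ++ ys) (suc (length xs + j))       ≡⟨ cong (λ t → x ∷ act₁ (xs ++ ys) t) (+-suc (length xs) j) ⟨
  x ∷ act₁ (xs ++ ys) (length xs + suc j)         ≡⟨ cong (x ∷_) (act₁-++ʳ xs ys j) ⟩
  x ∷ xs ++ act₁ ys (suc j)                       ∎
  where open ≡-Reasoning

act₁-at : ∀ xs a b ys → act₁ (xs ++ a ∷ b ∷ ys) (suc (length xs)) ≡ xs ++ actSwap 1 (a ∷ b ∷ ys)
act₁-at []       a b ys = refl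
act₁-at (x ∷ xs) a b ys = cong (x ∷_) (act₁-at xs a b ys)

act₁-after : ∀ xs y ys d → act₁ (xs ++ y ∷ ys) (suc (suc (length xs + d))) ≡ xs ++ y ∷ act₁ ys (suc d)
act₁-after []       y ys d = refl
act₁-after (x ∷ xs) y ys d = cong (x ∷_) (act₁-after xs y ys d)

actℕ-++ʳ : ∀ xs ys w → All (1 ≤_) w → actℕ (xs ++ ys) (map (length xs +_) w) ≡ xs ++ actℕ ys w
actℕ-++ʳ xs ys []      []       = refl
actℕ-++ʳ xs ys (suc j ∷ w) (_ ∷ ps) rewrite act₁-++ʳ xs ys j = actℕ-++ʳ xs (act₁ ys (suc j)) w ps

length-act₁ : ∀ r k → length (act₁ r k) ≡ length r
length-act₁ []          zero          = refl
length-act₁ (x ∷ r)     zero          = refl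
length-act₁ []          (suc zero)    = refl
length-act₁ (a ∷ [])    (suc zero)    = refl
length-act₁ (a ∷ b ∷ r) (suc zero)    rewrite actSwap₁-⊔⊓ a b r = refl
length-act₁ []          (suc (suc k)) = refl
length-act₁ (x ∷ r)     (suc (suc k)) = cong suc (length-act₁ r (suc k))

actℕ-++ˡ : ∀ xs zs w → All (_< length xs) w → actℕ (xs ++ zs) w ≡ actℕ xs w ++ zs
actℕ-++ˡ xs zs []      []       = refl
actℕ-++ˡ xs zs (k ∷ w) (p ∷ ps) rewrite act₁-++ˡ k xs zs p =
  actℕ-++ˡ (act₁ xs k) zs w (subst (λ l → All (_< l) w) (sym (length-act₁ xs k)) ps)

swap-∈ : ∀ {x a b} {r : List ℕ} → x ∈ a ∷ b ∷ r → x ∈ b ∷ a ∷ r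
swap-∈ (here e)         = there (here e)
swap-∈ (there (here e)) = here e
swap-∈ (there (there m)) = there (there m)

∈-actSwap⁻ : ∀ {x} r k → x ∈ actSwap (suc k) r → x ∈ r
∈-actSwap⁻ []          zero m = m
∈-actSwap⁻ (a ∷ [])    zero m = m
∈-actSwap⁻ (a ∷ b ∷ r) zero m with a <ᵇ b
... | false = m
... | true  = swap-∈ m
∈-actSwap⁻ []          (suc k) m         = m
∈-actSwap⁻ (y ∷ r)     (suc k) (here e)  = here e
∈-actSwap⁻ (y ∷ r)     (suc k) (there m) = there (∈-actSwap⁻ r k m)

∈-actSwap⁺ : ∀ {x} r k → x ∈ r → x ∈ actSwap (suc k) r
∈-actSwap⁺ []          zero m = m
∈-actSwap⁺ (a ∷ [])    zero m = m
∈-actSwap⁺ (a ∷ b ∷ r) zero m with a <ᵇ b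
... | false = m
... | true  = swap-∈ m
∈-actSwap⁺ []          (suc k) m         = m
∈-actSwap⁺ (y ∷ r)     (suc k) (here e)  = here e
∈-actSwap⁺ (y ∷ r)     (suc k) (there m) = there (∈-actSwap⁺ r k m)

∈-act₁⁻ : ∀ {x} r k → x ∈ act₁ r k → x ∈ r ⊎ x ≡ 0
∈-act₁⁻ (y ∷ r) zero    (here refl) = inj₂ refl
∈-act₁⁻ (y ∷ r) zero    (there m)   = inj₁ (there m)
∈-act₁⁻ r       (suc k) m           = inj₁ (∈-actSwap⁻ r k m)

∉-act₁ : ∀ {v} r k → v ≢ 0 → v ∉ r → v ∉ act₁ r k
∉-act₁ r k v≢0 v∉r m with ∈-act₁⁻ r k m
... | inj₁ m′ = v∉r m′
... | inj₂ e  = v≢0 e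

∈-insert : ∀ {v x : ℕ} xs ys → x ∈ xs ++ ys → x ∈ xs ++ v ∷ ys
∈-insert xs ys m with ∈-++⁻ xs m
... | inj₁ m′ = ∈-++⁺ˡ m′
... | inj₂ m′ = ∈-++⁺ʳ xs (there m′)

∈-delete : ∀ {v x : ℕ} xs ys → x ∈ xs ++ v ∷ ys → x ≢ v → x ∈ xs ++ ys
∈-delete xs ys m x≢v with ∈-++⁻ xs m
... | inj₁ m′         = ∈-++⁺ˡ m′
... | inj₂ (here e)   = ⊥-elim (x≢v e)
... | inj₂ (there m′) = ∈-++⁺ʳ xs m′

split-at-first : ∀ {v : ℕ} {r} → v ∈ r → ∃₂ λ xs ys → r ≡ xs ++ v ∷ ys × v ∉ xs
split-at-first {v} {x ∷ r} m with x ≟ v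
... | yes refl = [] , r , refl , λ ()
... | no x≢v with m
...   | here e   = ⊥-elim (x≢v (sym e))
...   | there m′ with split-at-first m′
...     | xs , ys , refl , v∉xs =
  x ∷ xs , ys , refl , λ { (here e) → x≢v (sym e) ; (there q) → v∉xs q }

split-at-last : ∀ {v : ℕ} {r} → v ∈ r → ∃₂ λ xs ys → r ≡ xs ++ v ∷ ys × v ∉ ys
split-at-last {v} {x ∷ r} m with v ∈? r
... | yes m′ with split-at-last m′
...   | xs , ys , refl , v∉ys = x ∷ xs , ys , refl , v∉ys
split-at-last {v} {x ∷ r} (here refl) | no v∉r = [] , r , refl , v∉r
split-at-last {v} {x ∷ r} (there m)   | no v∉r = ⊥-elim (v∉r m)

length-insert : ∀ {v : ℕ} xs ys → length (xs ++ v ∷ ys) ≡ suc (length (xs ++ ys))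
length-insert []       ys = refl
length-insert (x ∷ xs) ys = cong suc (length-insert xs ys)

length-split : ∀ {v : ℕ} {n} xs ys → length (xs ++ v ∷ ys) ≡ suc n → length xs + length ys ≡ n
length-split xs ys l = suc-injective (trans (cong suc (sym (length-++ xs))) (trans (sym (length-insert xs ys)) l))

length-snoc : ∀ (xs : List ℕ) x → length (xs ++ x ∷ []) ≡ suc (length xs)
length-snoc xs x = trans (length-++ xs) (+-comm (length xs) 1)

++-assoc₃ : ∀ (a b c d : List ℕ) → (a ++ b ++ c) ++ d ≡ a ++ b ++ c ++ d
++-assoc₃ a b c d = trans (++-assoc a (b ++ c) d) (cong (a ++_) (++-assoc b c d))

data Distinct : List ℕ → Set where
  []  : Distinct []
  _∷_ : ∀ {x xs} → x ≡ 0 ⊎ x ∉ xs → Distinct xs → Distinct (x ∷ xs)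

fresh-nonzero : ∀ {x} {xs : List ℕ} → x ≢ 0 → x ≡ 0 ⊎ x ∉ xs → x ∉ xs
fresh-nonzero x≢0 (inj₁ x≡0) = ⊥-elim (x≢0 x≡0)
fresh-nonzero _   (inj₂ x∉) = x∉

record Rook (n : ℕ) (r : List ℕ) : Set where
  constructor rook
  field
    length≡  : length r ≡ n
    bounded  : All (_≤ n) r
    distinct : Distinct r
open Rook public

Distinct-delete : ∀ {v} xs ys → Distinct (xs ++ v ∷ ys) → Distinct (xs ++ ys)
Distinct-delete []       ys (_ ∷ d) = d
Distinct-delete (x ∷ xs) ys (c ∷ d) = weaken c ∷ Distinct-delete xs ys d
  where
  weaken : x ≡ 0 ⊎ x ∉ xs ++ _ ∷ ys → x ≡ 0 ⊎ x ∉ xs ++ ys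
  weaken (inj₁ e)   = inj₁ e
  weaken (inj₂ x∉) = inj₂ (λ m → x∉ (∈-insert xs ys m))

Distinct-∉-after : ∀ {v} xs ys → Distinct (xs ++ v ∷ ys) → v ≢ 0 → v ∉ ys
Distinct-∉-after []       ys (inj₁ e   ∷ _) v≢0 = ⊥-elim (v≢0 e)
Distinct-∉-after []       ys (inj₂ v∉ ∷ _) v≢0 = v∉
Distinct-∉-after (x ∷ xs) ys (_ ∷ d)        v≢0 = Distinct-∉-after xs ys d v≢0

Distinct-∉-before : ∀ {v} xs ys → Distinct (xs ++ v ∷ ys) → v ≢ 0 → v ∉ xs
Distinct-∉-before (x ∷ xs) ys (inj₁ e   ∷ _) v≢0 (here refl) = v≢0 e
Distinct-∉-before (x ∷ xs) ys (inj₂ v∉ ∷ _) v≢0 (here refl) = v∉ (∈-++⁺ʳ xs (here refl))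
Distinct-∉-before (x ∷ xs) ys (_ ∷ d)        v≢0 (there m)   = Distinct-∉-before xs ys d v≢0 m

Distinct-act₁ : ∀ r k → Distinct r → Distinct (act₁ r k)
Distinct-act₁ []          zero          d       = d
Distinct-act₁ (x ∷ r)     zero          (_ ∷ d) = inj₁ refl ∷ d
Distinct-act₁ []          (suc zero)    d       = d
Distinct-act₁ (a ∷ [])    (suc zero)    d       = d
Distinct-act₁ (a ∷ b ∷ r) (suc zero)    (ca ∷ (cb ∷ d)) with a <ᵇ b in eq
... | false = ca ∷ (cb ∷ d)
... | true  = b-fresh cb ∷ (a-fresh ca ∷ d)
  where
  a<b : a < b
  a<b = <ᵇ⇒< a b (subst T (sym eq) tt)
  b-fresh : b ≡ 0 ⊎ b ∉ r → b ≡ 0 ⊎ b ∉ a ∷ r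
  b-fresh (inj₁ e)   = ⊥-elim (n≮0 (subst (a <_) e a<b))
  b-fresh (inj₂ b∉) = inj₂ λ { (here e) → <⇒≢ a<b (sym e) ; (there m) → b∉ m }
  a-fresh : a ≡ 0 ⊎ a ∉ b ∷ r → a ≡ 0 ⊎ a ∉ r
  a-fresh (inj₁ e)   = inj₁ e
  a-fresh (inj₂ a∉) = inj₂ λ m → a∉ (there m)
Distinct-act₁ []          (suc (suc k)) d       = d
Distinct-act₁ (x ∷ r)     (suc (suc k)) (c ∷ d) = fresh c ∷ Distinct-act₁ r (suc k) d
  where
  fresh : x ≡ 0 ⊎ x ∉ r → x ≡ 0 ⊎ x ∉ actSwap (suc k) r
  fresh (inj₁ e)   = inj₁ e
  fresh (inj₂ x∉) = inj₂ λ m → x∉ (∈-actSwap⁻ r k m)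

Rook-act₁ : ∀ {n} r k → Rook n r → Rook n (act₁ r k)
Rook-act₁ {n} r k (rook l b d) =
  rook (trans (length-act₁ r k) l) (tabulate bound) (Distinct-act₁ r k d)
  where
  bound : ∀ {x} → x ∈ act₁ r k → x ≤ n
  bound m with ∈-act₁⁻ r k m
  ... | inj₁ m′  = All.lookup b m′
  ... | inj₂ refl = z≤n

Rook-actℕ : ∀ {n} r w → Rook n r → Rook n (actℕ r w)
Rook-actℕ r []      R = R
Rook-actℕ r (k ∷ w) R = Rook-actℕ (act₁ r k) w (Rook-act₁ r k R)

Rook-delete : ∀ {n v} xs ys → Rook (suc n) (xs ++ v ∷ ys) → (∀ {x} → x ∈ xs ++ ys → x ≢ suc n) →
  Rook n (xs ++ ys)
Rook-delete xs ys (rook l b d) ≢top =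
  rook (suc-injective (trans (sym (length-insert xs ys)) l))
       (tabulate λ m → ≤-pred (≤∧≢⇒< (All.lookup b (∈-insert xs ys m)) (≢top m)))
       (Distinct-delete xs ys d)

Distinct-deleted-≢ : ∀ {v x} xs ys → Distinct (xs ++ v ∷ ys) → v ≢ 0 → v ∉ xs → x ∈ xs ++ ys → x ≢ v
Distinct-deleted-≢ xs ys d v≢0 v∉xs m refl with ∈-++⁻ xs m
... | inj₁ m′ = v∉xs m′
... | inj₂ m′ = Distinct-∉-after xs ys d v≢0 m′

Rook-delete-top : ∀ {n} xs ys → Rook (suc n) (xs ++ suc n ∷ ys) → suc n ∉ xs → Rook n (xs ++ ys)
Rook-delete-top xs ys R top∉xs = Rook-delete xs ys R (Distinct-deleted-≢ xs ys (distinct R) (λ ()) top∉xs)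

Rook-delete-zero : ∀ {n} xs ys → Rook (suc n) (xs ++ 0 ∷ ys) → suc n ∉ xs ++ 0 ∷ ys → Rook n (xs ++ ys)
Rook-delete-zero xs ys R top∉ = Rook-delete xs ys R λ m e → top∉ (subst (_∈ xs ++ 0 ∷ ys) e (∈-insert xs ys m))

Rook-zero-to-front : ∀ {n} xs ys → Rook n (xs ++ 0 ∷ ys) → Rook n (0 ∷ xs ++ ys)
Rook-zero-to-front xs ys (rook l b d) =
  rook (trans (sym (length-insert xs ys)) l) (z≤n ∷ tabulate λ m → All.lookup b (∈-insert xs ys m))
       (inj₁ refl ∷ Distinct-delete xs ys d)

pigeonhole : ∀ n r → Distinct r → All (λ x → 1 ≤ x × x ≤ n) r → length r ≤ n
pigeonhole zero    []      _ _                 = z≤n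
pigeonhole zero    (x ∷ r) _ ((1≤x , x≤0) ∷ _) = ⊥-elim (<⇒≱ 1≤x x≤0)
pigeonhole (suc n) r       d bounds with suc n ∈? r
... | no top∉r = m≤n⇒m≤1+n (pigeonhole n r d (tabulate λ m →
        lower (All.lookup bounds m) (λ { refl → top∉r m })))
  where
  lower : ∀ {x} → 1 ≤ x × x ≤ suc n → x ≢ suc n → 1 ≤ x × x ≤ n
  lower (p , q) x≢ = p , m<1+n⇒m≤n (≤∧≢⇒< q x≢)
... | yes m with split-at-first m
...   | xs , ys , refl , top∉xs = subst (_≤ suc n) (sym (length-insert xs ys))
        (s≤s (pigeonhole n (xs ++ ys) (Distinct-delete xs ys d) (tabulate λ m′ →
          lower (All.lookup bounds (∈-insert xs ys m′)) (Distinct-deleted-≢ xs ys d (λ ()) top∉xs m′))))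
  where
  lower : ∀ {x} → 1 ≤ x × x ≤ suc n → x ≢ suc n → 1 ≤ x × x ≤ n
  lower (p , q) x≢ = p , m<1+n⇒m≤n (≤∧≢⇒< q x≢)

desc : ℕ → ℕ → List ℕ
desc a zero    = []
desc a (suc k) = a + k ∷ desc a k

asc : ℕ → ℕ → List ℕ
asc a zero    = []
asc a (suc k) = a ∷ asc (suc a) k

desc-snoc : ∀ a k → desc a (suc k) ≡ desc (suc a) k ++ a ∷ []
desc-snoc a zero    = cong (_∷ []) (+-identityʳ a)
desc-snoc a (suc k) = cong₂ _∷_ (+-suc a k) (desc-snoc a k)

asc-snoc : ∀ a k → asc a (suc k) ≡ asc a k ++ a + k ∷ []
asc-snoc a zero    = cong (_∷ []) (sym (+-identityʳ a))
asc-snoc a (suc k) = cong (a ∷_) (trans (asc-snoc (suc a) k) (cong (λ t → asc (suc a) k ++ t ∷ []) (sym (+-suc a k))))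

map-suc-desc : ∀ a k → map suc (desc a k) ≡ desc (suc a) k
map-suc-desc a zero    = refl
map-suc-desc a (suc k) = cong (suc (a + k) ∷_) (map-suc-desc a k)

map-suc-asc : ∀ a k → map suc (asc a k) ≡ asc (suc a) k
map-suc-asc a zero    = refl
map-suc-asc a (suc k) = cong (suc a ∷_) (map-suc-asc (suc a) k)

InRange : ℕ → ℕ → ℕ → Set
InRange a k x = a ≤ x × x < a + k

desc-inRange : ∀ a k → All (InRange a k) (desc a k)
desc-inRange a zero    = []
desc-inRange a (suc k) = (m≤m+n a k , a+k<a+1+k) ∷ All.map (λ { (p , q) → p , <-trans q a+k<a+1+k }) (desc-inRange a k)
  where
  a+k<a+1+k : a + k < a + suc k
  a+k<a+1+k = +-monoʳ-< a (n<1+n k)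

asc-inRange : ∀ a k → All (InRange a k) (asc a k)
asc-inRange a zero    = []
asc-inRange a (suc k) = (≤-refl , m<m+n a (s≤s z≤n)) ∷ All.map widen (asc-inRange (suc a) k)
  where
  widen : ∀ {x} → InRange (suc a) k x → InRange a (suc k) x
  widen {x} (p , q) = <⇒≤ p , subst (x <_) (sym (+-suc a k)) q

asc-positive : ∀ q → All (1 ≤_) (asc 1 q)
asc-positive q = All.map proj₁ (asc-inRange 1 q)

desc-positive : ∀ k → All (1 ≤_) (desc 1 k)
desc-positive k = All.map proj₁ (desc-inRange 1 k)

asc-bounded : ∀ {n} q → q < n → All (_< n) (asc 1 q)
asc-bounded q q<n = All.map (λ { (_ , x<1+q) → ≤-trans x<1+q q<n }) (asc-inRange 1 q)

bubble-right : ∀ y xs ys → All (y <_) xs → actℕ (y ∷ xs ++ ys) (asc 1 (length xs)) ≡ xs ++ y ∷ ys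
bubble-right y []       ys []          = refl
bubble-right y (x ∷ xs) ys (y<x ∷ y<xs) = begin
    actℕ (actSwap 1 (y ∷ x ∷ xs ++ ys)) (asc 2 (length xs))
  ≡⟨ cong (λ t → actℕ t (asc 2 (length xs))) (actSwap₁-< (xs ++ ys) y<x) ⟩
    actℕ ((x ∷ []) ++ y ∷ xs ++ ys) (asc 2 (length xs))
  ≡⟨ cong (actℕ ((x ∷ []) ++ y ∷ xs ++ ys)) (map-suc-asc 1 (length xs)) ⟨
    actℕ ((x ∷ []) ++ y ∷ xs ++ ys) (map (1 +_) (asc 1 (length xs)))
  ≡⟨ actℕ-++ʳ (x ∷ []) (y ∷ xs ++ ys) (asc 1 (length xs)) (asc-positive (length xs)) ⟩
    x ∷ actℕ (y ∷ xs ++ ys) (asc 1 (length xs))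
  ≡⟨ cong (x ∷_) (bubble-right y xs ys y<xs) ⟩
    x ∷ xs ++ y ∷ ys
  ∎
  where open ≡-Reasoning

bubble-left : ∀ xs x ys → All (_< x) xs → actℕ (xs ++ x ∷ ys) (desc 1 (length xs)) ≡ x ∷ xs ++ ys
bubble-left []       x ys []           = refl
bubble-left (y ∷ xs) x ys (y<x ∷ xs<x) = begin
    actℕ (y ∷ xs ++ x ∷ ys) (desc 1 (suc (length xs)))
  ≡⟨ cong (actℕ (y ∷ xs ++ x ∷ ys)) (desc-snoc 1 (length xs)) ⟩
    actℕ (y ∷ xs ++ x ∷ ys) (desc 2 (length xs) ++ 1 ∷ [])
  ≡⟨ actℕ-++ (y ∷ xs ++ x ∷ ys) (desc 2 (length xs)) (1 ∷ []) ⟩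
    act₁ (actℕ ((y ∷ []) ++ xs ++ x ∷ ys) (desc 2 (length xs))) 1
  ≡⟨ cong (λ t → act₁ (actℕ ((y ∷ []) ++ xs ++ x ∷ ys) t) 1) (map-suc-desc 1 (length xs)) ⟨
    act₁ (actℕ ((y ∷ []) ++ xs ++ x ∷ ys) (map (1 +_) (desc 1 (length xs)))) 1
  ≡⟨ cong (λ t → act₁ t 1) (actℕ-++ʳ (y ∷ []) (xs ++ x ∷ ys) (desc 1 (length xs)) (desc-positive (length xs))) ⟩
    actSwap 1 (y ∷ actℕ (xs ++ x ∷ ys) (desc 1 (length xs)))
  ≡⟨ cong (λ t → actSwap 1 (y ∷ t)) (bubble-left xs x ys xs<x) ⟩
    actSwap 1 (y ∷ x ∷ xs ++ ys)
  ≡⟨ actSwap₁-< (xs ++ ys) y<x ⟩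
    x ∷ y ∷ xs ++ ys
  ∎
  where open ≡-Reasoning

≡ᵇ-refl : ∀ v → (v ≡ᵇ v) ≡ true
≡ᵇ-refl zero    = refl
≡ᵇ-refl (suc v) = ≡ᵇ-refl v

≢⇒≡ᵇ-false : ∀ {x v} → x ≢ v → (x ≡ᵇ v) ≡ false
≢⇒≡ᵇ-false {x} {v} x≢v with x ≡ᵇ v in eq
... | false = refl
... | true  = ⊥-elim (x≢v (≡ᵇ⇒≡ x v (subst T (sym eq) tt)))

memberᵇ : ℕ → List ℕ → Bool
memberᵇ v []       = false
memberᵇ v (x ∷ xs) = if x ≡ᵇ v then true else memberᵇ v xs

position : ℕ → List ℕ → ℕ
position v []       = 0
position v (x ∷ xs) = if x ≡ᵇ v then 0 else suc (position v xs)

deleteFirst : ℕ → List ℕ → List ℕ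
deleteFirst v []       = []
deleteFirst v (x ∷ xs) = if x ≡ᵇ v then xs else x ∷ deleteFirst v xs

module _ (v : ℕ) where

  memberᵇ-insert : ∀ xs ys → v ∉ xs → memberᵇ v (xs ++ v ∷ ys) ≡ true
  memberᵇ-insert []       ys _ rewrite ≡ᵇ-refl v = refl
  memberᵇ-insert (x ∷ xs) ys v∉ rewrite ≢⇒≡ᵇ-false {x} {v} (λ e → v∉ (here (sym e))) =
    memberᵇ-insert xs ys (v∉ ∘ there)

  position-insert : ∀ xs ys → v ∉ xs → position v (xs ++ v ∷ ys) ≡ length xs
  position-insert []       ys _ rewrite ≡ᵇ-refl v = refl
  position-insert (x ∷ xs) ys v∉ rewrite ≢⇒≡ᵇ-false {x} {v} (λ e → v∉ (here (sym e))) =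
    cong suc (position-insert xs ys (v∉ ∘ there))

  deleteFirst-insert : ∀ xs ys → v ∉ xs → deleteFirst v (xs ++ v ∷ ys) ≡ xs ++ ys
  deleteFirst-insert []       ys _ rewrite ≡ᵇ-refl v = refl
  deleteFirst-insert (x ∷ xs) ys v∉ rewrite ≢⇒≡ᵇ-false {x} {v} (λ e → v∉ (here (sym e))) =
    cong (x ∷_) (deleteFirst-insert xs ys (v∉ ∘ there))

  memberᵇ-∉ : ∀ r → v ∉ r → memberᵇ v r ≡ false
  memberᵇ-∉ []      _ = refl
  memberᵇ-∉ (x ∷ r) v∉ rewrite ≢⇒≡ᵇ-false {x} {v} (λ e → v∉ (here (sym e))) = memberᵇ-∉ r (v∉ ∘ there)

eraseTop : ℕ → List ℕ
eraseTop n = desc 0 (suc n)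

restrict : ℕ → List ℕ → List ℕ
restrict n r = if memberᵇ (suc n) r then deleteFirst (suc n) r else deleteFirst 0 r

insertionWord : ℕ → List ℕ → List ℕ
insertionWord n r =
  if memberᵇ (suc n) r
  then desc (suc (position (suc n) r)) (n ∸ position (suc n) r)
  else eraseTop n ++ asc 1 (position 0 r)

-- canonical n r takes 1_n to r: it builds restrict n r on the letters 1 … n,
-- leaving n+1 at the end, and then insertionWord n r either moves n+1 left
-- to its place, or moves it to the front, erases it and moves that zero right
-- to the place of the first zero of r.
canonical : ℕ → List ℕ → List ℕ
canonical zero    r = []
canonical (suc n) r = canonical n (restrict n r) ++ insertionWord n r

canonical-top : ∀ n xs ys → suc n ∉ xs → length (xs ++ suc n ∷ ys) ≡ suc n →
  canonical (suc n) (xs ++ suc n ∷ ys) ≡ canonical n (xs ++ ys) ++ desc (suc (length xs)) (length ys)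
canonical-top n xs ys top∉xs len
  rewrite memberᵇ-insert (suc n) xs ys top∉xs | deleteFirst-insert (suc n) xs ys top∉xs
        | position-insert (suc n) xs ys top∉xs =
  cong (λ t → canonical n (xs ++ ys) ++ desc (suc (length xs)) t) n∸p≡t
  where
  n∸p≡t : n ∸ length xs ≡ length ys
  n∸p≡t = trans (cong (_∸ length xs) (sym (length-split xs ys len))) (m+n∸m≡n (length xs) (length ys))

All≢0⇒0∉ : ∀ {xs} → All (_≢ 0) xs → 0 ∉ xs
All≢0⇒0∉ xs≢0 m = All.lookup xs≢0 m refl

canonical-zero : ∀ n xs ys → All (_≢ 0) xs → suc n ∉ xs ++ 0 ∷ ys →
  canonical (suc n) (xs ++ 0 ∷ ys) ≡ canonical n (xs ++ ys) ++ eraseTop n ++ asc 1 (length xs)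
canonical-zero n xs ys xs≢0 top∉
  rewrite memberᵇ-∉ (suc n) (xs ++ 0 ∷ ys) top∉ | deleteFirst-insert 0 xs ys (All≢0⇒0∉ xs≢0)
        | position-insert 0 xs ys (All≢0⇒0∉ xs≢0) = refl

data TopView (n : ℕ) (r : List ℕ) : Set where
  top-at  : ∀ xs ys → r ≡ xs ++ suc n ∷ ys → suc n ∉ xs → TopView n r
  zero-at : ∀ xs ys → r ≡ xs ++ 0 ∷ ys → All (_≢ 0) xs → suc n ∉ r → TopView n r

topView : ∀ n r → Rook (suc n) r → TopView n r
topView n r R with suc n ∈? r
... | yes top∈r with split-at-first top∈r
...   | xs , ys , r≡ , top∉xs = top-at xs ys r≡ top∉xs
topView n r R | no top∉r with 0 ∈? r
... | yes 0∈r with split-at-first 0∈r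
...   | xs , ys , r≡ , 0∉xs = zero-at xs ys r≡ (tabulate λ m e → 0∉xs (subst (_∈ xs) e m)) top∉r
topView n r (rook l b d) | no top∉r | no 0∉r =
  -- r would consist of n+1 distinct letters from 1 … n
  ⊥-elim (1+n≰n (subst (_≤ n) l (pigeonhole n r d (tabulate bounds))))
  where
  bounds : ∀ {x} → x ∈ r → 1 ≤ x × x ≤ n
  bounds {zero}  m = ⊥-elim (0∉r m)
  bounds {suc x} m = s≤s z≤n , m<1+n⇒m≤n (≤∧≢⇒< (All.lookup b m) (λ e → top∉r (subst (_∈ r) e m)))

FarFrom : ℕ → ℕ → Set
FarFrom j x = suc x < j ⊎ suc j < x

commute-past : ∀ {N} j w → j < N → All (λ x → FarFrom j x × x < N) w → Congℕ N (w ++ j ∷ []) (j ∷ w)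
commute-past         j []      _   []                   = c-refl
commute-past {N} j (x ∷ w) j<N ((far , x<N) ∷ rest) =
  c-trans (Congℕ-prepend (x ∷ []) (commute-past j w j<N rest)) (swap far)
  where
  swap : FarFrom j x → Congℕ N (x ∷ j ∷ w) (j ∷ x ∷ w)
  swap (inj₁ x+1<j) = c-base [] w (comm x j x+1<j j<N)
  swap (inj₂ j+1<x) = c-sym (c-base [] w (comm j x j+1<x x<N))

desc-shift : ∀ {N} a k j → a ≤ suc j → suc (suc j) < a + k → a + k ≤ N →
  Congℕ N (desc a k ++ suc (suc j) ∷ []) (suc j ∷ desc a k)
desc-shift a zero j a≤ j+2< _ =
  ⊥-elim (<⇒≱ (subst (suc (suc j) <_) (+-identityʳ a) j+2<) (m≤n⇒m≤1+n a≤))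
desc-shift {N} a (suc k) j a≤ j+2< a+k+1≤N with <-cmp (suc (suc j)) (a + k)
... | tri< j+2<a+k _ _ =
  c-trans (Congℕ-prepend (a + k ∷ []) (desc-shift a k j a≤ j+2<a+k (<⇒≤ a+k<N)))
          (c-sym (c-base [] (desc a k) (comm (suc j) (a + k) j+2<a+k a+k<N)))
  where
  a+k<N : a + k < N
  a+k<N = subst (_≤ N) (+-suc a k) a+k+1≤N
... | tri> _ _ j+2>a+k = ⊥-elim (<⇒≱ j+2>a+k (m<1+n⇒m≤n (subst (suc (suc j) <_) (+-suc a k) j+2<)))
... | tri≈ _ j+2≡a+k _ = braid-through k j+2≡a+k a+k+1≤N
  where
  braid-through : ∀ k → suc (suc j) ≡ a + k → a + suc k ≤ N →
    Congℕ N (desc a (suc k) ++ suc (suc j) ∷ []) (suc j ∷ desc a (suc k))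
  braid-through zero    j+2≡a _ = ⊥-elim (<⇒≱ (subst (suc j <_) (+-identityʳ a) (≤-reflexive j+2≡a)) a≤)
  braid-through (suc k) j+2≡ a+k+2≤N =
    subst₂ (Congℕ N) (cong₂ (λ u v → u ∷ v ∷ desc a k ++ suc (suc j) ∷ []) j+2≡ j+1≡)
                     (cong₂ (λ u v → suc j ∷ u ∷ v ∷ desc a k) j+2≡ j+1≡)
      (c-trans (Congℕ-prepend (suc (suc j) ∷ suc j ∷ []) (commute-past (suc (suc j)) (desc a k) j+2<N
                 (All.map far (desc-inRange a k))))
               (c-sym (c-base [] (desc a k) (braid j j+2<N))))
    where
    j+1≡ : suc j ≡ a + k
    j+1≡ = suc-injective (trans j+2≡ (+-suc a k))
    j+2<N : suc (suc j) < N
    j+2<N = subst (_≤ N) (trans (+-suc a (suc k)) (cong suc (sym j+2≡))) a+k+2≤N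
    far : ∀ {x} → InRange a k x → FarFrom (suc (suc j)) x × x < N
    far {x} (_ , x<a+k) = inj₁ (s≤s x<j+1) , <-trans x<j+1 (<-trans (n<1+n _) j+2<N)
      where
      x<j+1 : x < suc j
      x<j+1 = subst (x <_) (sym j+1≡) x<a+k

asc-shift : ∀ {N} a k j → 1 ≤ a → a ≤ j → suc j < a + k → a + k ≤ N →
  Congℕ N (asc a k ++ j ∷ []) (suc j ∷ asc a k)
asc-shift a zero j _ a≤j j+1< _ = ⊥-elim (<⇒≱ (subst (suc j <_) (+-identityʳ a) j+1<) (m≤n⇒m≤1+n a≤j))
asc-shift {N} a (suc k) j 1≤a a≤j j+1< a+k+1≤N with <-cmp a j
... | tri< a<j _ _ =
  c-trans (Congℕ-prepend (a ∷ []) (asc-shift (suc a) k j (m≤n⇒m≤1+n 1≤a) a<j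
                                     (subst (suc j <_) (+-suc a k) j+1<) (subst (_≤ N) (+-suc a k) a+k+1≤N)))
          (c-base [] (asc (suc a) k) (comm a (suc j) (s≤s a<j) (<-≤-trans j+1< a+k+1≤N)))
... | tri> _ _ a>j = ⊥-elim (<⇒≱ a>j a≤j)
... | tri≈ _ refl _ = braid-through k j+1< a+k+1≤N
  where
  braid-through : ∀ k → suc a < a + suc k → a + suc k ≤ N →
    Congℕ N (asc a (suc k) ++ a ∷ []) (suc a ∷ asc a (suc k))
  braid-through zero    a+1<a+1 _ = ⊥-elim (<-irrefl (sym (+-comm a 1)) a+1<a+1)
  braid-through (suc k) _ a+k+2≤N =
    c-trans (Congℕ-prepend (a ∷ suc a ∷ []) (commute-past a (asc (suc (suc a)) k) (<-≤-trans (m<m+n a (s≤s z≤n)) a+k+2≤N)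
              (All.map far (asc-inRange (suc (suc a)) k))))
            (braid-at a 1≤a a+2≤N)
    where
    a+k+2≡ : a + suc (suc k) ≡ suc (suc a) + k
    a+k+2≡ = trans (+-suc a (suc k)) (cong suc (+-suc a k))
    a+2≤N : suc (suc a) ≤ N
    a+2≤N = ≤-trans (s≤s (s≤s (m≤m+n a k))) (subst (_≤ N) a+k+2≡ a+k+2≤N)
    far : ∀ {x} → InRange (suc (suc a)) k x → FarFrom a x × x < N
    far (a+2≤x , x<) = inj₂ a+2≤x , <-≤-trans x< (subst (_≤ N) a+k+2≡ a+k+2≤N)
    braid-at : ∀ a → 1 ≤ a → suc (suc a) ≤ N →
      Congℕ N (a ∷ suc a ∷ a ∷ asc (suc (suc a)) k) (suc a ∷ a ∷ suc a ∷ asc (suc (suc a)) k)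
    braid-at (suc i) _ i+3≤N = c-base [] (asc (suc (suc (suc i))) k) (braid i i+3≤N)

asc-shift* : ∀ {N} a k w → 1 ≤ a → a + k ≤ N → All (λ j → a ≤ j × suc j < a + k) w →
  Congℕ N (asc a k ++ w) (map suc w ++ asc a k)
asc-shift*     a k []      _   _    []               = ≡⇒Congℕ (++-identityʳ _)
asc-shift* {N} a k (j ∷ w) 1≤a a+k≤N ((a≤j , j+1<) ∷ rest) = begin
  asc a k ++ j ∷ w               ≡⟨ ++-assoc (asc a k) (j ∷ []) w ⟨
  (asc a k ++ j ∷ []) ++ w       ≈⟨ Congℕ-append w (asc-shift a k j 1≤a a≤j j+1< a+k≤N) ⟩
  suc j ∷ asc a k ++ w           ≈⟨ Congℕ-prepend (suc j ∷ []) (asc-shift* a k w 1≤a a+k≤N rest) ⟩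
  suc j ∷ map suc w ++ asc a k   ∎
  where open ≈-Reasoning N

eraseTop-shift* : ∀ n w → All (λ x → 1 ≤ x × suc x ≤ n) w → Congℕ (suc n) (w ++ eraseTop n) (eraseTop n ++ map suc w)
eraseTop-shift* n []          []             = ≡⇒Congℕ (sym (++-identityʳ (eraseTop n)))
eraseTop-shift* n (suc x ∷ w) ((_ , x+2≤n) ∷ rest) = begin
  suc x ∷ w ++ eraseTop n                     ≈⟨ Congℕ-prepend (suc x ∷ []) (eraseTop-shift* n w rest) ⟩
  suc x ∷ eraseTop n ++ map suc w             ≈⟨ Congℕ-append (map suc w) (desc-shift 0 (suc n) x z≤n (s≤s x+2≤n) ≤-refl) ⟨
  (eraseTop n ++ suc (suc x) ∷ []) ++ map suc w ≡⟨ ++-assoc (eraseTop n) _ (map suc w) ⟩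
  eraseTop n ++ suc (suc x) ∷ map suc w       ∎
  where open ≈-Reasoning (suc n)

eraseTop-suc : ∀ m → eraseTop (suc m) ≡ desc 2 m ++ 1 ∷ 0 ∷ []
eraseTop-suc m = trans (desc-snoc 0 (suc m)) (trans (cong (_++ 0 ∷ []) (desc-snoc 1 m)) (++-assoc (desc 2 m) (1 ∷ []) (0 ∷ [])))

zero-commutes-desc : ∀ m → Congℕ (suc (suc m)) (desc 2 m ++ 0 ∷ []) (0 ∷ desc 2 m)
zero-commutes-desc m = commute-past 0 (desc 2 m) (s≤s z≤n) (All.map (λ { (2≤x , x<) → inj₂ 2≤x , x< }) (desc-inRange 2 m))

eraseTop-1-0 : ∀ m → Congℕ (suc (suc m)) (eraseTop (suc m) ++ 1 ∷ 0 ∷ []) (0 ∷ eraseTop (suc m))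
eraseTop-1-0 m = begin
  eraseTop (suc m) ++ 1 ∷ 0 ∷ []        ≡⟨ cong (_++ 1 ∷ 0 ∷ []) (eraseTop-suc m) ⟩
  (D ++ 1 ∷ 0 ∷ []) ++ 1 ∷ 0 ∷ []       ≡⟨ ++-assoc D _ _ ⟩
  D ++ 1 ∷ 0 ∷ 1 ∷ 0 ∷ []               ≈⟨ c-base D [] (rel0a (s≤s (s≤s z≤n))) ⟩
  D ++ 0 ∷ 1 ∷ 0 ∷ []                   ≡⟨ ++-assoc D (0 ∷ []) _ ⟨
  (D ++ 0 ∷ []) ++ 1 ∷ 0 ∷ []           ≈⟨ Congℕ-append _ (zero-commutes-desc m) ⟩
  0 ∷ D ++ 1 ∷ 0 ∷ []                   ≡⟨ cong (0 ∷_) (eraseTop-suc m) ⟨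
  0 ∷ eraseTop (suc m)                  ∎
  where
  D = desc 2 m
  open ≈-Reasoning (suc (suc m))

zero-eraseTop-1 : ∀ m → Congℕ (suc (suc m)) (0 ∷ eraseTop (suc m) ++ 1 ∷ []) (0 ∷ eraseTop (suc m))
zero-eraseTop-1 m = begin
  0 ∷ eraseTop (suc m) ++ 1 ∷ []        ≡⟨ cong (λ t → 0 ∷ t ++ 1 ∷ []) (eraseTop-suc m) ⟩
  0 ∷ (D ++ 1 ∷ 0 ∷ []) ++ 1 ∷ []       ≡⟨ cong (0 ∷_) (++-assoc D _ _) ⟩
  (0 ∷ D) ++ 1 ∷ 0 ∷ 1 ∷ []             ≈⟨ Congℕ-append _ (zero-commutes-desc m) ⟨
  (D ++ 0 ∷ []) ++ 1 ∷ 0 ∷ 1 ∷ []       ≡⟨ ++-assoc D _ _ ⟩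
  D ++ 0 ∷ 1 ∷ 0 ∷ 1 ∷ []               ≈⟨ c-base D [] (rel0b (s≤s (s≤s z≤n))) ⟩
  D ++ 0 ∷ 1 ∷ 0 ∷ []                   ≡⟨ ++-assoc D (0 ∷ []) _ ⟨
  (D ++ 0 ∷ []) ++ 1 ∷ 0 ∷ []           ≈⟨ Congℕ-append _ (zero-commutes-desc m) ⟩
  0 ∷ D ++ 1 ∷ 0 ∷ []                   ≡⟨ cong (0 ∷_) (eraseTop-suc m) ⟨
  0 ∷ eraseTop (suc m)                  ∎
  where
  D = desc 2 m
  open ≈-Reasoning (suc (suc m))

asc-below : ∀ {n} q → q < n → All (λ x → 1 ≤ x × suc x ≤ n) (asc 1 q)
asc-below q q<n = All.map (λ { (1≤x , x<1+q) → 1≤x , ≤-trans x<1+q q<n }) (asc-inRange 1 q)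

eraseTop-asc-0 : ∀ n q → suc q ≤ n →
  Congℕ (suc n) (eraseTop n ++ asc 1 (suc q) ++ 0 ∷ []) (0 ∷ asc 1 q ++ eraseTop n)
eraseTop-asc-0 (suc m) q (s≤s q≤m) = begin
  G ++ 1 ∷ asc 2 q ++ 0 ∷ []      ≈⟨ Congℕ-prepend G (Congℕ-prepend (1 ∷ []) (commute-past 0 (asc 2 q) (s≤s z≤n) (All.map far (asc-inRange 2 q)))) ⟩
  G ++ 1 ∷ 0 ∷ asc 2 q            ≡⟨ ++-assoc G (1 ∷ 0 ∷ []) (asc 2 q) ⟨
  (G ++ 1 ∷ 0 ∷ []) ++ asc 2 q    ≈⟨ Congℕ-append (asc 2 q) (eraseTop-1-0 m) ⟩
  0 ∷ G ++ asc 2 q                ≡⟨ cong (λ t → 0 ∷ G ++ t) (map-suc-asc 1 q) ⟨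
  0 ∷ G ++ map suc (asc 1 q)      ≈⟨ Congℕ-prepend (0 ∷ []) (eraseTop-shift* (suc m) (asc 1 q) (asc-below q (s≤s q≤m))) ⟨
  0 ∷ asc 1 q ++ G                ∎
  where
  G = eraseTop (suc m)
  open ≈-Reasoning (suc (suc m))
  far : ∀ {x} → InRange 2 q x → FarFrom 0 x × x < suc (suc m)
  far (2≤x , x<2+q) = inj₂ 2≤x , ≤-trans x<2+q (s≤s (s≤s q≤m))

eraseTop-asc-absorbs : ∀ n q → suc q ≤ n →
  Congℕ (suc n) (0 ∷ asc 1 q ++ eraseTop n ++ asc 1 q ++ suc q ∷ []) (0 ∷ asc 1 q ++ eraseTop n ++ asc 1 q)
eraseTop-asc-absorbs (suc m) q (s≤s q≤m) = begin
  0 ∷ U ++ G ++ U ++ suc q ∷ []        ≡⟨ cong (λ t → 0 ∷ U ++ G ++ t) (asc-snoc 1 q) ⟨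
  0 ∷ U ++ G ++ asc 1 (suc q)          ≡⟨ cong (0 ∷_) (++-assoc U G _) ⟨
  0 ∷ (U ++ G) ++ asc 1 (suc q)        ≈⟨ Congℕ-prepend (0 ∷ []) (Congℕ-append (asc 1 (suc q)) (eraseTop-shift* (suc m) U U-below)) ⟩
  0 ∷ (G ++ map suc U) ++ asc 1 (suc q) ≡⟨ cong (0 ∷_) (trans (++-assoc G _ _) (cong (λ t → G ++ t ++ asc 1 (suc q)) (map-suc-asc 1 q))) ⟩
  0 ∷ G ++ asc 2 q ++ asc 1 (suc q)    ≈⟨ Congℕ-prepend (0 ∷ G) (c-sym shift-U) ⟩
  0 ∷ G ++ 1 ∷ asc 2 q ++ U            ≡⟨ cong (0 ∷_) (++-assoc G (1 ∷ []) _) ⟨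
  (0 ∷ G ++ 1 ∷ []) ++ asc 2 q ++ U    ≈⟨ Congℕ-append (asc 2 q ++ U) (zero-eraseTop-1 m) ⟩
  0 ∷ G ++ asc 2 q ++ U                ≡⟨ cong (0 ∷_) (trans (++-assoc G _ _) (cong (λ t → G ++ t ++ U) (map-suc-asc 1 q))) ⟨
  0 ∷ (G ++ map suc U) ++ U            ≈⟨ Congℕ-prepend (0 ∷ []) (Congℕ-append U (eraseTop-shift* (suc m) U U-below)) ⟨
  0 ∷ (U ++ G) ++ U                    ≡⟨ cong (0 ∷_) (++-assoc U G U) ⟩
  0 ∷ U ++ G ++ U                      ∎
  where
  U = asc 1 q
  G = eraseTop (suc m)
  open ≈-Reasoning (suc (suc m))
  U-below : All (λ x → 1 ≤ x × suc x ≤ suc m) U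
  U-below = asc-below q (s≤s q≤m)
  shift-U : Congℕ (suc (suc m)) (asc 1 (suc q) ++ U) (asc 2 q ++ asc 1 (suc q))
  shift-U = subst (λ t → Congℕ (suc (suc m)) (asc 1 (suc q) ++ U) (t ++ asc 1 (suc q))) (map-suc-asc 1 q)
    (asc-shift* 1 (suc q) U ≤-refl (s≤s (s≤s q≤m)) (All.map (λ { (1≤x , x<1+q) → 1≤x , s≤s x<1+q }) (asc-inRange 1 q)))

eraseTop-asc-commute-below : ∀ n q k → suc k < q → q ≤ n →
  Congℕ (suc n) (eraseTop n ++ asc 1 q ++ suc k ∷ []) (suc k ∷ eraseTop n ++ asc 1 q)
eraseTop-asc-commute-below n q k k+1<q q≤n = begin
  eraseTop n ++ asc 1 q ++ suc k ∷ []        ≈⟨ Congℕ-prepend (eraseTop n) (asc-shift 1 q (suc k) ≤-refl (s≤s z≤n) (s≤s k+1<q) (s≤s q≤n)) ⟩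
  eraseTop n ++ suc (suc k) ∷ asc 1 q        ≡⟨ ++-assoc (eraseTop n) _ _ ⟨
  (eraseTop n ++ suc (suc k) ∷ []) ++ asc 1 q ≈⟨ Congℕ-append (asc 1 q) (desc-shift 0 (suc n) k z≤n (s≤s (<-≤-trans k+1<q q≤n)) ≤-refl) ⟩
  suc k ∷ eraseTop n ++ asc 1 q              ∎
  where open ≈-Reasoning (suc n)

eraseTop-asc-commute-above : ∀ n q j → q ≤ j → suc (suc j) ≤ n →
  Congℕ (suc n) (eraseTop n ++ asc 1 q ++ suc (suc j) ∷ []) (suc j ∷ eraseTop n ++ asc 1 q)
eraseTop-asc-commute-above n q j q≤j j+2≤n = begin
  eraseTop n ++ asc 1 q ++ suc (suc j) ∷ []  ≈⟨ Congℕ-prepend (eraseTop n) (commute-past (suc (suc j)) (asc 1 q) (s≤s j+2≤n) (All.map far (asc-inRange 1 q))) ⟩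
  eraseTop n ++ suc (suc j) ∷ asc 1 q        ≡⟨ ++-assoc (eraseTop n) _ _ ⟨
  (eraseTop n ++ suc (suc j) ∷ []) ++ asc 1 q ≈⟨ Congℕ-append (asc 1 q) (desc-shift 0 (suc n) j z≤n (s≤s j+2≤n) ≤-refl) ⟩
  suc j ∷ eraseTop n ++ asc 1 q              ∎
  where
  open ≈-Reasoning (suc n)
  far : ∀ {x} → InRange 1 q x → FarFrom (suc (suc j)) x × x < suc n
  far (_ , x<1+q) = inj₁ (s≤s (≤-trans x<1+q (s≤s q≤j))) , ≤-trans x<1+q (s≤s (≤-trans q≤j (≤-trans (n≤1+n j) (<⇒≤ j+2≤n))))

desc-commute-below : ∀ {N} p t k → k < p → suc p + t ≤ N → Congℕ N (desc (suc p) t ++ k ∷ []) (k ∷ desc (suc p) t)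
desc-commute-below p t k k<p p+t+1≤N =
  commute-past k (desc (suc p) t) (≤-trans (s≤s (≤-trans (<⇒≤ k<p) (m≤m+n p t))) p+t+1≤N)
    (All.map (λ { (p+1≤x , x<) → inj₂ (<-≤-trans (s≤s k<p) p+1≤x) , <-≤-trans x< p+t+1≤N }) (desc-inRange (suc p) t))

desc-idem : ∀ {N} a t → a + suc t ≤ N → Congℕ N (desc a (suc t) ++ a ∷ []) (desc a (suc t))
desc-idem {N} a t a+t+1≤N = begin
  desc a (suc t) ++ a ∷ []           ≡⟨ cong (_++ a ∷ []) (desc-snoc a t) ⟩
  (D ++ a ∷ []) ++ a ∷ []            ≡⟨ ++-assoc D _ _ ⟩
  D ++ a ∷ a ∷ []                    ≈⟨ c-base D [] (idem a (<-≤-trans (m<m+n a (s≤s z≤n)) a+t+1≤N)) ⟩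
  D ++ a ∷ []                        ≡⟨ desc-snoc a t ⟨
  desc a (suc t)                     ∎
  where
  D = desc (suc a) t
  open ≈-Reasoning N

asc-idem : ∀ {N} a q → a + q < N → Congℕ N (asc a (suc q) ++ a + q ∷ []) (asc a (suc q))
asc-idem {N} a q a+q<N = begin
  asc a (suc q) ++ a + q ∷ []        ≡⟨ cong (_++ a + q ∷ []) (asc-snoc a q) ⟩
  (A ++ a + q ∷ []) ++ a + q ∷ []    ≡⟨ ++-assoc A _ _ ⟩
  A ++ a + q ∷ a + q ∷ []            ≈⟨ c-base A [] (idem (a + q) a+q<N) ⟩
  A ++ a + q ∷ []                    ≡⟨ asc-snoc a q ⟨
  asc a (suc q)                      ∎
  where
  A = asc a q
  open ≈-Reasoning N

-- Faithfulness of the action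

data Relative (p : ℕ) : ℕ → Set where
  before : ∀ {k} → k < p → Relative p k
  at     : Relative p p
  next   : Relative p (suc p)
  beyond : ∀ d → Relative p (suc (suc (p + d)))

relative : ∀ k p → Relative p k
relative zero          zero    = at
relative zero          (suc p) = before (s≤s z≤n)
relative (suc zero)    zero    = next
relative (suc (suc d)) zero    = beyond d
relative (suc k)       (suc p) with relative k p
... | before k<p = before (s≤s k<p)
... | at         = at
... | next       = next
... | beyond d   = beyond d

CanonicalStep : ℕ → Set
CanonicalStep n = ∀ r k → Rook n r → k < n → Congℕ n (canonical n r ++ k ∷ []) (canonical n (act₁ r k))

canonical-actℕ : ∀ n → CanonicalStep n → ∀ r w → Rook n r → All (_< n) w →
  Congℕ n (canonical n r ++ w) (canonical n (actℕ r w))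
canonical-actℕ n step r []      R []          = ≡⇒Congℕ (++-identityʳ _)
canonical-actℕ n step r (k ∷ w) R (k<n ∷ w<n) = begin
  canonical n r ++ k ∷ w            ≡⟨ ++-assoc (canonical n r) (k ∷ []) w ⟨
  (canonical n r ++ k ∷ []) ++ w    ≈⟨ Congℕ-append w (step r k R k<n) ⟩
  canonical n (act₁ r k) ++ w       ≈⟨ canonical-actℕ n step (act₁ r k) w (Rook-act₁ r k R) w<n ⟩
  canonical n (actℕ (act₁ r k) w)   ∎
  where open ≈-Reasoning n

-- The step for π_k is proved by comparing k with the position of the letter
-- n+1 of r (step-top-…) or, if n+1 is absent, of its first zero (step-zero-…).
module _ (n : ℕ) (step : CanonicalStep n) where

  step-under : ∀ {s k} → Rook n s → k < n → ∀ T →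
    Congℕ (suc n) ((canonical n s ++ k ∷ []) ++ T) (canonical n (act₁ s k) ++ T)
  step-under R k<n T = Congℕ-append T (Congℕ-weaken (step _ _ R k<n))

  no-position-after-last : ∀ {v} xs → Rook (suc n) (xs ++ v ∷ []) → ¬ (length xs < n)
  no-position-after-last xs R = <-irrefl (trans (sym (+-identityʳ _)) (length-split xs [] (length≡ R)))

  StepAt : List ℕ → ℕ → Set
  StepAt r k = Congℕ (suc n) (canonical (suc n) r ++ k ∷ []) (canonical (suc n) (act₁ r k))

  step-top-below : ∀ xs ys k → Rook (suc n) (xs ++ suc n ∷ ys) → suc n ∉ xs → k < length xs →
    StepAt (xs ++ suc n ∷ ys) k
  step-top-below xs ys k R top∉xs k<p = begin
    canonical (suc n) (xs ++ suc n ∷ ys) ++ k ∷ []   ≡⟨ cong (_++ k ∷ []) (canonical-top n xs ys top∉xs (length≡ R)) ⟩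
    (canonical n s ++ D) ++ k ∷ []                  ≡⟨ ++-assoc (canonical n s) D _ ⟩
    canonical n s ++ D ++ k ∷ []                    ≈⟨ Congℕ-prepend (canonical n s) (desc-commute-below p t k k<p (≤-reflexive (cong suc p+t≡n))) ⟩
    canonical n s ++ k ∷ D                          ≡⟨ ++-assoc (canonical n s) (k ∷ []) D ⟨
    (canonical n s ++ k ∷ []) ++ D                  ≈⟨ step-under (Rook-delete-top xs ys R top∉xs) (<-≤-trans k<p p≤n) D ⟩
    canonical n (act₁ s k) ++ D                     ≡⟨ cong₂ (λ u l → canonical n u ++ desc (suc l) t) (act₁-++ˡ k xs ys k<p) (sym (length-act₁ xs k)) ⟩
    canonical n (xs′ ++ ys) ++ desc (suc (length xs′)) t ≡⟨ canonical-top n xs′ ys (∉-act₁ xs k (λ ()) top∉xs) length-r·k ⟨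
    canonical (suc n) (xs′ ++ suc n ∷ ys)           ≡⟨ cong (canonical (suc n)) r·k≡ ⟨
    canonical (suc n) (act₁ (xs ++ suc n ∷ ys) k)   ∎
    where
    open ≈-Reasoning (suc n)
    s = xs ++ ys
    p = length xs
    t = length ys
    D = desc (suc p) t
    xs′ = act₁ xs k
    p+t≡n : p + t ≡ n
    p+t≡n = length-split xs ys (length≡ R)
    p≤n : p ≤ n
    p≤n = subst (p ≤_) p+t≡n (m≤m+n p t)
    r·k≡ : act₁ (xs ++ suc n ∷ ys) k ≡ xs′ ++ suc n ∷ ys
    r·k≡ = act₁-++ˡ k xs (suc n ∷ ys) k<p
    length-r·k : length (xs′ ++ suc n ∷ ys) ≡ suc n
    length-r·k = trans (cong length (sym r·k≡)) (length≡ (Rook-act₁ _ k R))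

  step-top-erase : ∀ ys → Rook (suc n) (suc n ∷ ys) → StepAt (suc n ∷ ys) 0
  step-top-erase ys R = begin
    canonical (suc n) (suc n ∷ ys) ++ 0 ∷ []    ≡⟨ cong (_++ 0 ∷ []) (canonical-top n [] ys (λ ()) (length≡ R)) ⟩
    (canonical n ys ++ desc 1 t) ++ 0 ∷ []      ≡⟨ ++-assoc (canonical n ys) _ _ ⟩
    canonical n ys ++ desc 1 t ++ 0 ∷ []        ≡⟨ cong (canonical n ys ++_) (desc-snoc 0 t) ⟨
    canonical n ys ++ desc 0 (suc t)            ≡⟨ cong (λ l → canonical n ys ++ desc 0 (suc l)) t≡n ⟩
    canonical n ys ++ eraseTop n                ≡⟨ cong (canonical n ys ++_) (++-identityʳ (eraseTop n)) ⟨
    canonical n ys ++ eraseTop n ++ []          ≡⟨ canonical-zero n [] ys [] top∉0∷ys ⟨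
    canonical (suc n) (0 ∷ ys)                  ∎
    where
    open ≈-Reasoning (suc n)
    t = length ys
    t≡n : t ≡ n
    t≡n = length-split {suc n} [] ys (length≡ R)
    top∉0∷ys : suc n ∉ 0 ∷ ys
    top∉0∷ys (here ())
    top∉0∷ys (there m) = Distinct-∉-after [] ys (distinct R) (λ ()) m

  step-top-swap : ∀ xs′ z ys → Rook (suc n) ((xs′ ∷ʳ z) ++ suc n ∷ ys) → suc n ∉ xs′ ∷ʳ z →
    StepAt ((xs′ ∷ʳ z) ++ suc n ∷ ys) (length (xs′ ∷ʳ z))
  step-top-swap xs′ z ys R top∉xs = begin
    canonical (suc n) (xs ++ suc n ∷ ys) ++ length xs ∷ []
      ≡⟨ cong (_++ length xs ∷ []) (canonical-top n xs ys top∉xs (length≡ R)) ⟩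
    (canonical n (xs ++ ys) ++ desc (suc (length xs)) t) ++ length xs ∷ []
      ≡⟨ cong₂ (λ u l → (canonical n u ++ desc (suc l) t) ++ l ∷ []) (++-assoc xs′ (z ∷ []) ys) (length-snoc xs′ z) ⟩
    (canonical n (xs′ ++ z ∷ ys) ++ desc (suc (suc p′)) t) ++ suc p′ ∷ []
      ≡⟨ ++-assoc (canonical n (xs′ ++ z ∷ ys)) _ _ ⟩
    canonical n (xs′ ++ z ∷ ys) ++ desc (suc (suc p′)) t ++ suc p′ ∷ []
      ≡⟨ cong (canonical n (xs′ ++ z ∷ ys) ++_) (desc-snoc (suc p′) t) ⟨
    canonical n (xs′ ++ z ∷ ys) ++ desc (suc p′) (suc t)
      ≡⟨ canonical-top n xs′ (z ∷ ys) (top∉xs ∘ ∈-++⁺ˡ) length-r·k ⟨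
    canonical (suc n) (xs′ ++ suc n ∷ z ∷ ys)
      ≡⟨ cong (canonical (suc n)) r·k≡ ⟨
    canonical (suc n) (act₁ (xs ++ suc n ∷ ys) (length xs))
      ∎
    where
    open ≈-Reasoning (suc n)
    xs = xs′ ∷ʳ z
    p′ = length xs′
    t = length ys
    z<top : z < suc n
    z<top = ≤∧≢⇒< (All.lookup (bounded R) (∈-++⁺ˡ (∈-++⁺ʳ xs′ (here refl)))) λ { refl → top∉xs (∈-++⁺ʳ xs′ (here refl)) }
    r·k≡ : act₁ (xs ++ suc n ∷ ys) (length xs) ≡ xs′ ++ suc n ∷ z ∷ ys
    r·k≡ = trans (cong₂ act₁ (++-assoc xs′ (z ∷ []) (suc n ∷ ys)) (length-snoc xs′ z))
                 (trans (act₁-at xs′ z (suc n) ys) (cong (xs′ ++_) (actSwap₁-< ys z<top)))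
    length-r·k : length (xs′ ++ suc n ∷ z ∷ ys) ≡ suc n
    length-r·k = trans (cong length (sym r·k≡)) (length≡ (Rook-act₁ _ (length xs) R))

  step-top-sorted : ∀ xs ys → Rook (suc n) (xs ++ suc n ∷ ys) → suc n ∉ xs → suc (length xs) < suc n →
    StepAt (xs ++ suc n ∷ ys) (suc (length xs))
  step-top-sorted xs [] R _ p<n = ⊥-elim (no-position-after-last xs R (≤-pred p<n))
  step-top-sorted xs (y ∷ ys) R top∉xs _ = begin
    canonical (suc n) r ++ suc p ∷ []                       ≡⟨ cong (_++ suc p ∷ []) (canonical-top n xs (y ∷ ys) top∉xs (length≡ R)) ⟩
    (canonical n s ++ desc (suc p) (suc t)) ++ suc p ∷ []   ≡⟨ ++-assoc (canonical n s) _ _ ⟩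
    canonical n s ++ desc (suc p) (suc t) ++ suc p ∷ []     ≈⟨ Congℕ-prepend (canonical n s) (desc-idem (suc p) t (≤-reflexive (cong suc (length-split xs (y ∷ ys) (length≡ R))))) ⟩
    canonical n s ++ desc (suc p) (suc t)                   ≡⟨ canonical-top n xs (y ∷ ys) top∉xs (length≡ R) ⟨
    canonical (suc n) r                                     ≡⟨ cong (canonical (suc n)) r·k≡r ⟨
    canonical (suc n) (act₁ r (suc p))                      ∎
    where
    open ≈-Reasoning (suc n)
    r = xs ++ suc n ∷ y ∷ ys
    s = xs ++ y ∷ ys
    p = length xs
    t = length ys
    r·k≡r : act₁ r (suc p) ≡ r
    r·k≡r = trans (act₁-at xs (suc n) y ys) (cong (xs ++_) (actSwap₁-≥ ys (All.lookup (bounded R) (∈-++⁺ʳ xs (there (here refl))))))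

  step-top-beyond : ∀ xs ys d → Rook (suc n) (xs ++ suc n ∷ ys) → suc n ∉ xs → suc (suc (length xs + d)) < suc n →
    StepAt (xs ++ suc n ∷ ys) (suc (suc (length xs + d)))
  step-top-beyond xs ys d R top∉xs k<1+n = begin
    canonical (suc n) r ++ suc (suc j) ∷ []     ≡⟨ cong (_++ suc (suc j) ∷ []) (canonical-top n xs ys top∉xs (length≡ R)) ⟩
    (canonical n s ++ D) ++ suc (suc j) ∷ []    ≡⟨ ++-assoc (canonical n s) D _ ⟩
    canonical n s ++ D ++ suc (suc j) ∷ []      ≈⟨ Congℕ-prepend (canonical n s) (desc-shift (suc p) t j (s≤s (m≤m+n p d)) k<1+p+t (≤-reflexive (cong suc p+t≡n))) ⟩
    canonical n s ++ suc j ∷ D                  ≡⟨ ++-assoc (canonical n s) (suc j ∷ []) D ⟨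
    (canonical n s ++ suc j ∷ []) ++ D          ≈⟨ step-under (Rook-delete-top xs ys R top∉xs) (≤-pred k<1+n) D ⟩
    canonical n (act₁ s (suc j)) ++ D           ≡⟨ cong₂ (λ u l → canonical n u ++ desc (suc p) l) s·k≡ (sym (length-act₁ ys (suc d))) ⟩
    canonical n (xs ++ ys′) ++ desc (suc p) (length ys′) ≡⟨ canonical-top n xs ys′ top∉xs length-r·k ⟨
    canonical (suc n) (xs ++ suc n ∷ ys′)       ≡⟨ cong (canonical (suc n)) (act₁-after xs (suc n) ys d) ⟨
    canonical (suc n) (act₁ r (suc (suc j)))    ∎
    where
    open ≈-Reasoning (suc n)
    r = xs ++ suc n ∷ ys
    s = xs ++ ys
    p = length xs
    t = length ys
    j = p + d
    D = desc (suc p) t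
    ys′ = act₁ ys (suc d)
    p+t≡n : p + t ≡ n
    p+t≡n = length-split xs ys (length≡ R)
    k<1+p+t : suc (suc j) < suc p + t
    k<1+p+t = subst (suc (suc j) <_) (cong suc (sym p+t≡n)) k<1+n
    s·k≡ : act₁ s (suc j) ≡ xs ++ ys′
    s·k≡ = trans (cong (act₁ s) (sym (+-suc p d))) (act₁-++ʳ xs ys d)
    length-r·k : length (xs ++ suc n ∷ ys′) ≡ suc n
    length-r·k = trans (cong length (sym (act₁-after xs (suc n) ys d))) (length≡ (Rook-act₁ r (suc (suc j)) R))

  step-top : ∀ xs ys k → Rook (suc n) (xs ++ suc n ∷ ys) → suc n ∉ xs → k < suc n → StepAt (xs ++ suc n ∷ ys) k
  step-top xs ys k R top∉xs k<1+n with relative k (length xs)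
  ... | before k<p = step-top-below xs ys k R top∉xs k<p
  ... | next       = step-top-sorted xs ys R top∉xs k<1+n
  ... | beyond d   = step-top-beyond xs ys d R top∉xs k<1+n
  ... | at with reverseView xs
  ...   | []           = step-top-erase ys R
  ...   | xs′ ∶ _ ∶ʳ z = step-top-swap xs′ z ys R top∉xs

  step-zero-erase : ∀ x xs ys → Rook (suc n) (x ∷ xs ++ 0 ∷ ys) → All (_≢ 0) (x ∷ xs) → suc n ∉ x ∷ xs ++ 0 ∷ ys →
    StepAt (x ∷ xs ++ 0 ∷ ys) 0
  step-zero-erase x xs ys R xs≢0 top∉ = begin
    canonical (suc n) r ++ 0 ∷ []                ≡⟨ cong (_++ 0 ∷ []) (canonical-zero n (x ∷ xs) ys xs≢0 top∉) ⟩
    (canonical n s ++ G ++ asc 1 (suc q)) ++ 0 ∷ [] ≡⟨ ++-assoc₃ (canonical n s) G _ _ ⟩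
    canonical n s ++ G ++ asc 1 (suc q) ++ 0 ∷ []   ≈⟨ Congℕ-prepend (canonical n s) (eraseTop-asc-0 n q q<n) ⟩
    canonical n s ++ 0 ∷ U ++ G                  ≡⟨ ++-assoc (canonical n s) (0 ∷ U) G ⟨
    (canonical n s ++ 0 ∷ U) ++ G                ≈⟨ Congℕ-append G (Congℕ-weaken (canonical-actℕ n step s (0 ∷ U) (Rook-delete-zero (x ∷ xs) ys R top∉) (≤-trans (s≤s z≤n) q<n ∷ asc-bounded q q<n))) ⟩
    canonical n (actℕ (0 ∷ xs ++ ys) U) ++ G     ≡⟨ cong (λ u → canonical n u ++ G) (bubble-right 0 xs ys (All.map n≢0⇒n>0 xs≢0′)) ⟩
    canonical n (xs ++ 0 ∷ ys) ++ G              ≡⟨ cong (canonical n (xs ++ 0 ∷ ys) ++_) (++-identityʳ G) ⟨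
    canonical n (xs ++ 0 ∷ ys) ++ G ++ []        ≡⟨ canonical-zero n [] (xs ++ 0 ∷ ys) [] (∉-act₁ r 0 (λ ()) top∉) ⟨
    canonical (suc n) (act₁ r 0)                 ∎
    where
    open ≈-Reasoning (suc n)
    r = x ∷ xs ++ 0 ∷ ys
    s = x ∷ xs ++ ys
    q = length xs
    G = eraseTop n
    U = asc 1 q
    xs≢0′ : All (_≢ 0) xs
    xs≢0′ = All.tail xs≢0
    q<n : q < n
    q<n = subst (suc q ≤_) (length-split (x ∷ xs) ys (length≡ R)) (m≤m+n (suc q) (length ys))

  step-zero-below : ∀ xs ys k → Rook (suc n) (xs ++ 0 ∷ ys) → All (_≢ 0) xs → suc n ∉ xs ++ 0 ∷ ys →
    suc k < length xs → StepAt (xs ++ 0 ∷ ys) (suc k)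
  step-zero-below xs ys k R xs≢0 top∉ k+1<q = begin
    canonical (suc n) r ++ suc k ∷ []           ≡⟨ cong (_++ suc k ∷ []) (canonical-zero n xs ys xs≢0 top∉) ⟩
    (canonical n s ++ G ++ U) ++ suc k ∷ []     ≡⟨ ++-assoc₃ (canonical n s) G U _ ⟩
    canonical n s ++ G ++ U ++ suc k ∷ []       ≈⟨ Congℕ-prepend (canonical n s) (eraseTop-asc-commute-below n q k k+1<q q≤n) ⟩
    canonical n s ++ suc k ∷ G ++ U             ≡⟨ ++-assoc (canonical n s) (suc k ∷ []) _ ⟨
    (canonical n s ++ suc k ∷ []) ++ G ++ U     ≈⟨ step-under (Rook-delete-zero xs ys R top∉) (<-≤-trans k+1<q q≤n) (G ++ U) ⟩
    canonical n (act₁ s (suc k)) ++ G ++ U      ≡⟨ cong₂ (λ u l → canonical n u ++ G ++ asc 1 l) (act₁-++ˡ (suc k) xs ys k+1<q) (sym (length-act₁ xs (suc k))) ⟩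
    canonical n (xs′ ++ ys) ++ G ++ asc 1 (length xs′) ≡⟨ canonical-zero n xs′ ys xs′≢0 top∉′ ⟨
    canonical (suc n) (xs′ ++ 0 ∷ ys)           ≡⟨ cong (canonical (suc n)) r·k≡ ⟨
    canonical (suc n) (act₁ r (suc k))          ∎
    where
    open ≈-Reasoning (suc n)
    r = xs ++ 0 ∷ ys
    s = xs ++ ys
    q = length xs
    G = eraseTop n
    U = asc 1 q
    xs′ = act₁ xs (suc k)
    q≤n : q ≤ n
    q≤n = subst (q ≤_) (length-split xs ys (length≡ R)) (m≤m+n q (length ys))
    r·k≡ : act₁ r (suc k) ≡ xs′ ++ 0 ∷ ys
    r·k≡ = act₁-++ˡ (suc k) xs (0 ∷ ys) k+1<q
    xs′≢0 : All (_≢ 0) xs′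
    xs′≢0 = tabulate λ m → All.lookup xs≢0 (∈-actSwap⁻ xs k m)
    top∉′ : suc n ∉ xs′ ++ 0 ∷ ys
    top∉′ m = ∉-act₁ r (suc k) (λ ()) top∉ (subst (suc n ∈_) (sym r·k≡) m)

  step-zero-fixed : ∀ ys → suc n ∉ 0 ∷ ys → StepAt (0 ∷ ys) 0
  step-zero-fixed ys top∉ = begin
    canonical (suc n) (0 ∷ ys) ++ 0 ∷ []     ≡⟨ cong (_++ 0 ∷ []) (canonical-zero n [] ys [] top∉) ⟩
    (canonical n ys ++ G ++ []) ++ 0 ∷ []    ≡⟨ ++-assoc₃ (canonical n ys) G [] _ ⟩
    canonical n ys ++ G ++ 0 ∷ []            ≈⟨ Congℕ-prepend (canonical n ys) (desc-idem 0 n ≤-refl) ⟩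
    canonical n ys ++ G                      ≡⟨ cong (canonical n ys ++_) (++-identityʳ G) ⟨
    canonical n ys ++ G ++ []                ≡⟨ canonical-zero n [] ys [] top∉ ⟨
    canonical (suc n) (0 ∷ ys)               ∎
    where
    open ≈-Reasoning (suc n)
    G = eraseTop n

  step-zero-sorted : ∀ xs′ z ys → Rook (suc n) ((xs′ ∷ʳ z) ++ 0 ∷ ys) → All (_≢ 0) (xs′ ∷ʳ z) →
    suc n ∉ (xs′ ∷ʳ z) ++ 0 ∷ ys → StepAt ((xs′ ∷ʳ z) ++ 0 ∷ ys) (length (xs′ ∷ʳ z))
  step-zero-sorted xs′ z ys R xs≢0 top∉ = begin
    canonical (suc n) r ++ length xs ∷ []                ≡⟨ cong (_++ length xs ∷ []) (canonical-zero n xs ys xs≢0 top∉) ⟩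
    (canonical n s ++ G ++ asc 1 (length xs)) ++ length xs ∷ [] ≡⟨ ++-assoc₃ (canonical n s) G _ _ ⟩
    canonical n s ++ G ++ asc 1 (length xs) ++ length xs ∷ []   ≡⟨ cong (λ l → canonical n s ++ G ++ asc 1 l ++ l ∷ []) (length-snoc xs′ z) ⟩
    canonical n s ++ G ++ asc 1 (suc q′) ++ suc q′ ∷ []  ≈⟨ Congℕ-prepend (canonical n s) (Congℕ-prepend G (asc-idem 1 q′ q′<n)) ⟩
    canonical n s ++ G ++ asc 1 (suc q′)                 ≡⟨ cong (λ l → canonical n s ++ G ++ asc 1 l) (length-snoc xs′ z) ⟨
    canonical n s ++ G ++ asc 1 (length xs)              ≡⟨ canonical-zero n xs ys xs≢0 top∉ ⟨
    canonical (suc n) r                                  ≡⟨ cong (canonical (suc n)) r·k≡r ⟨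
    canonical (suc n) (act₁ r (length xs))               ∎
    where
    open ≈-Reasoning (suc n)
    xs = xs′ ∷ʳ z
    r = xs ++ 0 ∷ ys
    s = xs ++ ys
    q′ = length xs′
    G = eraseTop n
    q′<n : suc q′ < suc n
    q′<n = s≤s (subst (_≤ n) (length-snoc xs′ z) (subst (length xs ≤_) (length-split xs ys (length≡ R)) (m≤m+n _ (length ys))))
    r·k≡r : act₁ r (length xs) ≡ r
    r·k≡r = trans (cong₂ act₁ (++-assoc xs′ (z ∷ []) (0 ∷ ys)) (length-snoc xs′ z))
                  (trans (act₁-at xs′ z 0 ys) (trans (cong (xs′ ++_) (actSwap₁-≥ ys z≤n)) (sym (++-assoc xs′ (z ∷ []) (0 ∷ ys)))))

  step-zero-double : ∀ xs ys → Rook (suc n) (xs ++ 0 ∷ 0 ∷ ys) → All (_≢ 0) xs → suc n ∉ xs ++ 0 ∷ 0 ∷ ys →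
    length xs < n → StepAt (xs ++ 0 ∷ 0 ∷ ys) (suc (length xs))
  step-zero-double xs ys R xs≢0 top∉ q<n = begin
    canonical (suc n) r ++ suc q ∷ []             ≡⟨ cong (_++ suc q ∷ []) (canonical-zero n xs (0 ∷ ys) xs≢0 top∉) ⟩
    (canonical n s ++ G ++ U) ++ suc q ∷ []       ≡⟨ ++-assoc₃ (canonical n s) G U _ ⟩
    canonical n s ++ G ++ U ++ suc q ∷ []         ≡⟨ cong (λ u → canonical n u ++ G ++ U ++ suc q ∷ []) s≡ ⟨
    canonical n (actℕ s̃ (0 ∷ U)) ++ G ++ U ++ suc q ∷ [] ≈⟨ Congℕ-append _ to-canonical ⟨
    (canonical n s̃ ++ 0 ∷ U) ++ G ++ U ++ suc q ∷ [] ≡⟨ ++-assoc (canonical n s̃) (0 ∷ U) _ ⟩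
    canonical n s̃ ++ 0 ∷ U ++ G ++ U ++ suc q ∷ []   ≈⟨ Congℕ-prepend (canonical n s̃) (eraseTop-asc-absorbs n q q<n) ⟩
    canonical n s̃ ++ 0 ∷ U ++ G ++ U              ≡⟨ ++-assoc (canonical n s̃) (0 ∷ U) _ ⟨
    (canonical n s̃ ++ 0 ∷ U) ++ G ++ U            ≈⟨ Congℕ-append _ to-canonical ⟩
    canonical n (actℕ s̃ (0 ∷ U)) ++ G ++ U        ≡⟨ cong (λ u → canonical n u ++ G ++ U) s≡ ⟩
    canonical n s ++ G ++ U                       ≡⟨ canonical-zero n xs (0 ∷ ys) xs≢0 top∉ ⟨
    canonical (suc n) r                           ≡⟨ cong (canonical (suc n)) r·k≡r ⟨
    canonical (suc n) (act₁ r (suc q))            ∎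
    where
    open ≈-Reasoning (suc n)
    r = xs ++ 0 ∷ 0 ∷ ys
    s = xs ++ 0 ∷ ys
    s̃ = 0 ∷ xs ++ ys
    q = length xs
    G = eraseTop n
    U = asc 1 q
    s≡ : actℕ s̃ (0 ∷ U) ≡ s
    s≡ = bubble-right 0 xs ys (All.map n≢0⇒n>0 xs≢0)
    to-canonical : Congℕ (suc n) (canonical n s̃ ++ 0 ∷ U) (canonical n (actℕ s̃ (0 ∷ U)))
    to-canonical = Congℕ-weaken (canonical-actℕ n step s̃ (0 ∷ U) (Rook-zero-to-front xs ys (Rook-delete-zero xs (0 ∷ ys) R top∉))
                                   (≤-trans (s≤s z≤n) q<n ∷ asc-bounded q q<n))
    r·k≡r : act₁ r (suc q) ≡ r
    r·k≡r = act₁-at xs 0 0 ys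

  step-zero-swap : ∀ xs y ys → All (_≢ 0) xs → suc n ∉ xs ++ 0 ∷ y ∷ ys → y ≢ 0 →
    StepAt (xs ++ 0 ∷ y ∷ ys) (suc (length xs))
  step-zero-swap xs y ys xs≢0 top∉ y≢0 = begin
    canonical (suc n) r ++ suc q ∷ []           ≡⟨ cong (_++ suc q ∷ []) (canonical-zero n xs (y ∷ ys) xs≢0 top∉) ⟩
    (canonical n s ++ G ++ asc 1 q) ++ suc q ∷ [] ≡⟨ ++-assoc₃ (canonical n s) G _ _ ⟩
    canonical n s ++ G ++ asc 1 q ++ suc q ∷ [] ≡⟨ cong₂ (λ u U → canonical n u ++ G ++ U) (++-assoc xs (y ∷ []) ys) (asc-snoc 1 q) ⟨
    canonical n (xs′ ++ ys) ++ G ++ asc 1 (suc q) ≡⟨ cong (λ l → canonical n (xs′ ++ ys) ++ G ++ asc 1 l) (length-snoc xs y) ⟨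
    canonical n (xs′ ++ ys) ++ G ++ asc 1 (length xs′) ≡⟨ canonical-zero n xs′ ys xs′≢0 top∉′ ⟨
    canonical (suc n) (xs′ ++ 0 ∷ ys)          ≡⟨ cong (canonical (suc n)) r·k≡ ⟨
    canonical (suc n) (act₁ r (suc q))          ∎
    where
    open ≈-Reasoning (suc n)
    r = xs ++ 0 ∷ y ∷ ys
    s = xs ++ y ∷ ys
    q = length xs
    G = eraseTop n
    xs′ = xs ∷ʳ y
    r·k≡ : act₁ r (suc q) ≡ xs′ ++ 0 ∷ ys
    r·k≡ = trans (act₁-at xs 0 y ys) (trans (cong (xs ++_) (actSwap₁-< ys (n≢0⇒n>0 y≢0))) (sym (++-assoc xs (y ∷ []) (0 ∷ ys))))
    xs′≢0 : All (_≢ 0) (xs′)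
    xs′≢0 = ++⁺ xs≢0 (y≢0 ∷ [])
    top∉′ : suc n ∉ xs′ ++ 0 ∷ ys
    top∉′ m = ∉-act₁ r (suc q) (λ ()) top∉ (subst (suc n ∈_) (sym r·k≡) m)

  step-zero-beyond : ∀ xs ys d → Rook (suc n) (xs ++ 0 ∷ ys) → All (_≢ 0) xs → suc n ∉ xs ++ 0 ∷ ys →
    suc (suc (length xs + d)) < suc n → StepAt (xs ++ 0 ∷ ys) (suc (suc (length xs + d)))
  step-zero-beyond xs ys d R xs≢0 top∉ (s≤s j+2≤n) = begin
    canonical (suc n) r ++ suc (suc j) ∷ []       ≡⟨ cong (_++ suc (suc j) ∷ []) (canonical-zero n xs ys xs≢0 top∉) ⟩
    (canonical n s ++ G ++ U) ++ suc (suc j) ∷ [] ≡⟨ ++-assoc₃ (canonical n s) G U _ ⟩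
    canonical n s ++ G ++ U ++ suc (suc j) ∷ []   ≈⟨ Congℕ-prepend (canonical n s) (eraseTop-asc-commute-above n q j (m≤m+n q d) j+2≤n) ⟩
    canonical n s ++ suc j ∷ G ++ U               ≡⟨ ++-assoc (canonical n s) (suc j ∷ []) _ ⟨
    (canonical n s ++ suc j ∷ []) ++ G ++ U       ≈⟨ step-under (Rook-delete-zero xs ys R top∉) j+2≤n (G ++ U) ⟩
    canonical n (act₁ s (suc j)) ++ G ++ U        ≡⟨ cong (λ u → canonical n u ++ G ++ U) s·k≡ ⟩
    canonical n (xs ++ ys′) ++ G ++ U             ≡⟨ canonical-zero n xs ys′ xs≢0 top∉′ ⟨
    canonical (suc n) (xs ++ 0 ∷ ys′)             ≡⟨ cong (canonical (suc n)) (act₁-after xs 0 ys d) ⟨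
    canonical (suc n) (act₁ r (suc (suc j)))      ∎
    where
    open ≈-Reasoning (suc n)
    r = xs ++ 0 ∷ ys
    s = xs ++ ys
    q = length xs
    j = q + d
    G = eraseTop n
    U = asc 1 q
    ys′ = act₁ ys (suc d)
    s·k≡ : act₁ s (suc j) ≡ xs ++ ys′
    s·k≡ = trans (cong (act₁ s) (sym (+-suc q d))) (act₁-++ʳ xs ys d)
    top∉′ : suc n ∉ xs ++ 0 ∷ ys′
    top∉′ m = ∉-act₁ r (suc (suc j)) (λ ()) top∉ (subst (suc n ∈_) (sym (act₁-after xs 0 ys d)) m)

  step-zero-at : ∀ xs ys → Rook (suc n) (xs ++ 0 ∷ ys) → All (_≢ 0) xs → suc n ∉ xs ++ 0 ∷ ys →
    StepAt (xs ++ 0 ∷ ys) (length xs)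
  step-zero-at xs ys R xs≢0 top∉ with reverseView xs
  ... | []           = step-zero-fixed ys top∉
  ... | xs′ ∶ _ ∶ʳ z = step-zero-sorted xs′ z ys R xs≢0 top∉

  step-zero-next : ∀ xs ys → Rook (suc n) (xs ++ 0 ∷ ys) → All (_≢ 0) xs → suc n ∉ xs ++ 0 ∷ ys →
    suc (length xs) < suc n → StepAt (xs ++ 0 ∷ ys) (suc (length xs))
  step-zero-next xs []       R _    _    q<n       = ⊥-elim (no-position-after-last xs R (≤-pred q<n))
  step-zero-next xs (y ∷ ys) R xs≢0 top∉ (s≤s q<n) with y ≟ 0
  ... | yes refl = step-zero-double xs ys R xs≢0 top∉ q<n
  ... | no y≢0   = step-zero-swap xs y ys xs≢0 top∉ y≢0

  step-zero-before : ∀ xs ys k → Rook (suc n) (xs ++ 0 ∷ ys) → All (_≢ 0) xs → suc n ∉ xs ++ 0 ∷ ys →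
    k < length xs → StepAt (xs ++ 0 ∷ ys) k
  step-zero-before (x ∷ xs) ys zero    R xs≢0 top∉ _   = step-zero-erase x xs ys R xs≢0 top∉
  step-zero-before xs       ys (suc k) R xs≢0 top∉ k<q = step-zero-below xs ys k R xs≢0 top∉ k<q

  step-zero : ∀ xs ys k → Rook (suc n) (xs ++ 0 ∷ ys) → All (_≢ 0) xs → suc n ∉ xs ++ 0 ∷ ys →
    k < suc n → StepAt (xs ++ 0 ∷ ys) k
  step-zero xs ys k R xs≢0 top∉ k<1+n with relative k (length xs)
  ... | before k<q = step-zero-before xs ys k R xs≢0 top∉ k<q
  ... | at         = step-zero-at xs ys R xs≢0 top∉
  ... | next       = step-zero-next xs ys R xs≢0 top∉ k<1+n
  ... | beyond d   = step-zero-beyond xs ys d R xs≢0 top∉ k<1+n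

canonical-step : ∀ n → CanonicalStep n
canonical-step zero    r k R ()
canonical-step (suc n) r k R k<1+n with topView n r R
... | top-at  xs ys refl top∉xs   = step-top n (canonical-step n) xs ys k R top∉xs k<1+n
... | zero-at xs ys refl xs≢0 top∉ = step-zero n (canonical-step n) xs ys k R xs≢0 top∉ k<1+n

one-snoc : ∀ n → one (suc n) ≡ one n ++ suc n ∷ []
one-snoc n = trans (cong (map suc) (sym (applyUpTo-∷ʳ id n))) (map-++ suc (upTo n) (n ∷ []))

length-one : ∀ n → length (one n) ≡ n
length-one n = trans (length-map suc (upTo n)) (length-applyUpTo id n)

one-inRange : ∀ n {x} → x ∈ one n → 1 ≤ x × x ≤ n
one-inRange zero    ()
one-inRange (suc n) {x} m with ∈-++⁻ (one n) (subst (x ∈_) (one-snoc n) m)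
... | inj₁ m′          = proj₁ (one-inRange n m′) , m≤n⇒m≤1+n (proj₂ (one-inRange n m′))
... | inj₂ (here refl) = s≤s z≤n , ≤-refl

suc-∉-one : ∀ n → suc n ∉ one n
suc-∉-one n m = 1+n≰n (proj₂ (one-inRange n m))

Distinct-snoc : ∀ xs {v} → Distinct xs → v ∉ xs → Distinct (xs ++ v ∷ [])
Distinct-snoc []       _       _    = inj₂ (λ ()) ∷ []
Distinct-snoc (x ∷ xs) (c ∷ d) v∉ = fresh c ∷ Distinct-snoc xs d (v∉ ∘ there)
  where
  fresh : x ≡ 0 ⊎ x ∉ xs → x ≡ 0 ⊎ x ∉ xs ++ _ ∷ []
  fresh (inj₁ e)   = inj₁ e
  fresh (inj₂ x∉) = inj₂ λ m → case (∈-++⁻ xs m)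
    where
    case : x ∈ xs ⊎ x ∈ _ ∷ [] → _
    case (inj₁ m′)          = x∉ m′
    case (inj₂ (here refl)) = v∉ (here refl)

Rook-one : ∀ n → Rook n (one n)
Rook-one zero    = rook refl [] []
Rook-one (suc n) = rook (length-one (suc n)) (tabulate (proj₂ ∘ one-inRange (suc n)))
  (subst Distinct (sym (one-snoc n)) (Distinct-snoc (one n) (distinct (Rook-one n)) (suc-∉-one n)))

canonical-one : ∀ n → canonical n (one n) ≡ []
canonical-one zero    = refl
canonical-one (suc n) = begin
  canonical (suc n) (one (suc n))                         ≡⟨ cong (canonical (suc n)) (one-snoc n) ⟩
  canonical (suc n) (one n ++ suc n ∷ [])                 ≡⟨ canonical-top n (one n) [] (suc-∉-one n) length-top ⟩
  canonical n (one n ++ []) ++ []                         ≡⟨ ++-identityʳ _ ⟩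
  canonical n (one n ++ [])                               ≡⟨ cong (canonical n) (++-identityʳ (one n)) ⟩
  canonical n (one n)                                     ≡⟨ canonical-one n ⟩
  []                                                      ∎
  where
  open ≡-Reasoning
  length-top : length (one n ++ suc n ∷ []) ≡ suc n
  length-top = trans (cong length (sym (one-snoc n))) (length-one (suc n))

toℕ-bounded : ∀ {n} (w : List (Fin n)) → All (_< n) (map toℕ w)
toℕ-bounded []      = []
toℕ-bounded (k ∷ w) = toℕ<n k ∷ toℕ-bounded w

Rook-act-one : ∀ n (π : List (Fin n)) → Rook n (act (one n) π)
Rook-act-one n π = subst (Rook n) (sym (act≡actℕ (one n) π)) (Rook-actℕ (one n) (map toℕ π) (Rook-one n))

word≈canonical : ∀ n (π : List (Fin n)) → Congℕ n (map toℕ π) (canonical n (act (one n) π))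
word≈canonical n π =
  subst₂ (Congℕ n) (cong (_++ map toℕ π) (canonical-one n)) (cong (canonical n) (sym (act≡actℕ (one n) π)))
    (canonical-actℕ n (canonical-step n) (one n) (map toℕ π) (Rook-one n) (toℕ-bounded π))

-- Both sides are congruent to the canonical word of r.
LeqR-of-actℕ : ∀ n (πr πu : List (Fin n)) w → All (_< n) w → actℕ (act (one n) πu) w ≡ act (one n) πr →
  LeqR n πr πu
LeqR-of-actℕ zero    []       []       w _   _ = [] , c-refl
LeqR-of-actℕ zero    (() ∷ _) _        _ _   _
LeqR-of-actℕ zero    []       (() ∷ _) _ _   _
LeqR-of-actℕ (suc n) πr       πu       w w<n u·w≡r = map (clamp n) w ,
  subst₂ (Cong (suc n)) (map-clamp-toℕ n πr)
    (trans (map-++ (clamp n) (map toℕ πu) w) (cong (_++ map (clamp n) w) (map-clamp-toℕ n πu)))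
    (Congℕ⇒Cong πr≈πu·w)
  where
  open ≈-Reasoning (suc n)
  u = act (one (suc n)) πu
  πr≈πu·w : Congℕ (suc n) (map toℕ πr) (map toℕ πu ++ w)
  πr≈πu·w = begin
    map toℕ πr                                 ≈⟨ word≈canonical (suc n) πr ⟩
    canonical (suc n) (act (one (suc n)) πr)   ≡⟨ cong (canonical (suc n)) u·w≡r ⟨
    canonical (suc n) (actℕ u w)               ≈⟨ canonical-actℕ (suc n) (canonical-step (suc n)) u w (Rook-act-one (suc n) πu) w<n ⟨
    canonical (suc n) u ++ w                   ≈⟨ Congℕ-append w (word≈canonical (suc n) πu) ⟨
    map toℕ πu ++ w                            ∎

-- Generators move rooks down in ≤I

data Before : List ℕ → ℕ → ℕ → Set where
  now   : ∀ {b a ys} → a ∈ ys → Before (b ∷ ys) b a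
  later : ∀ {x b a ys} → Before ys b a → Before (x ∷ ys) b a

Before-split : ∀ xs ys {b a} → a ∈ ys → Before (xs ++ b ∷ ys) b a
Before-split []       ys a∈ = now a∈
Before-split (x ∷ xs) ys a∈ = later (Before-split xs ys a∈)

Before⇒split : ∀ {r b a} → Before r b a → ∃₂ λ xs ys → r ≡ xs ++ b ∷ ys × a ∈ ys
Before⇒split (now {ys = ys} a∈) = [] , ys , refl , a∈
Before⇒split (later {x = x} B) with Before⇒split B
... | xs , ys , refl , a∈ = x ∷ xs , ys , refl , a∈

Inv⇒Before : ∀ {r b a} → Inv r b a → Before r b a
Inv⇒Before (_ , _ , xs , ys , refl , a∈) = Before-split xs ys a∈

Before⇒Inv : ∀ {r b a} → 0 < a → a < b → Before r b a → Inv r b a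
Before⇒Inv 0<a a<b B = 0<a , a<b , Before⇒split B

Before-∈ : ∀ {r b a} → Before r b a → a ∈ r
Before-∈ (now a∈)  = there a∈
Before-∈ (later B) = there (Before-∈ B)

Before-insert : ∀ xs ys {c b a} → Before (xs ++ ys) b a → Before (xs ++ c ∷ ys) b a
Before-insert []       ys B         = later B
Before-insert (x ∷ xs) ys (now a∈)  = now (∈-insert xs ys a∈)
Before-insert (x ∷ xs) ys (later B) = later (Before-insert xs ys B)

Before-init : ∀ r {y b a} → Before (r ++ y ∷ []) b a → a ≢ y → Before r b a
Before-init []      (now ())   _
Before-init []      (later ()) _
Before-init (x ∷ r) (now a∈) a≢y with ∈-++⁻ r a∈
... | inj₁ a∈r       = now a∈r
... | inj₂ (here e)  = ⊥-elim (a≢y e)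
Before-init (x ∷ r) (later B) a≢y = later (Before-init r B a≢y)

∉⇒¬Before-last : ∀ r {y a} → y ∉ r → Before (r ++ y ∷ []) y a → ⊥
∉⇒¬Before-last []      _    (now ())
∉⇒¬Before-last []      _    (later ())
∉⇒¬Before-last (x ∷ r) y∉r (now _)   = y∉r (here refl)
∉⇒¬Before-last (x ∷ r) y∉r (later B) = ∉⇒¬Before-last r (y∉r ∘ there) B

Before-actSwap : ∀ j u {b a} → Before u b a → a < b → Before (actSwap (suc j) u) b a
Before-actSwap zero    (x ∷ [])    B a<b = B
Before-actSwap zero    (x ∷ y ∷ u) B a<b with x <ᵇ y in eq
... | false = B
... | true  = swapped B a<b
  where
  x<y : x < y
  x<y = <ᵇ⇒< x y (subst T (sym eq) tt)
  swapped : ∀ {b a} → Before (x ∷ y ∷ u) b a → a < b → Before (y ∷ x ∷ u) b a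
  swapped (now (here refl))   a<b = ⊥-elim (<⇒≯ x<y a<b)
  swapped (now (there a∈))    _   = later (now a∈)
  swapped (later (now a∈))    _   = now (there a∈)
  swapped (later (later B))   _   = later (later B)
Before-actSwap (suc j) (x ∷ u) (now a∈)  _   = now (∈-actSwap⁺ u j a∈)
Before-actSwap (suc j) (x ∷ u) (later B) a<b = later (Before-actSwap j u B a<b)

count0-insert : ∀ xs ys c → c ≢ 0 → count0 (xs ++ c ∷ ys) ≡ count0 (xs ++ ys)
count0-insert []          ys zero    c≢0 = ⊥-elim (c≢0 refl)
count0-insert []          ys (suc c) _   = refl
count0-insert (zero ∷ xs)  ys c c≢0 = cong suc (count0-insert xs ys c c≢0)
count0-insert (suc x ∷ xs) ys c c≢0 = count0-insert xs ys c c≢0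

count0-insert-zero : ∀ xs ys → count0 (xs ++ 0 ∷ ys) ≡ suc (count0 (xs ++ ys))
count0-insert-zero []           ys = refl
count0-insert-zero (zero ∷ xs)  ys = cong suc (count0-insert-zero xs ys)
count0-insert-zero (suc x ∷ xs) ys = count0-insert-zero xs ys

count0-nonzero : ∀ xs → All (_≢ 0) xs → count0 xs ≡ 0
count0-nonzero []           []          = refl
count0-nonzero (zero ∷ xs)  (0≢0 ∷ _)   = ⊥-elim (0≢0 refl)
count0-nonzero (suc x ∷ xs) (_ ∷ xs≢0)  = count0-nonzero xs xs≢0

count0-positive : ∀ xs → 0 ∈ xs → 1 ≤ count0 xs
count0-positive (zero ∷ xs)  _          = s≤s z≤n
count0-positive (suc x ∷ xs) (there m)  = count0-positive xs m

count0-actSwap : ∀ j u → count0 (actSwap (suc j) u) ≡ count0 u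
count0-actSwap zero    []          = refl
count0-actSwap zero    (a ∷ [])    = refl
count0-actSwap zero    (a ∷ b ∷ u) with a <ᵇ b
... | false = refl
... | true  = exchange a b
  where
  exchange : ∀ a b → count0 (b ∷ a ∷ u) ≡ count0 (a ∷ b ∷ u)
  exchange zero    zero    = refl
  exchange zero    (suc b) = refl
  exchange (suc a) zero    = refl
  exchange (suc a) (suc b) = refl
count0-actSwap (suc j) []          = refl
count0-actSwap (suc j) (zero ∷ u)  = cong suc (count0-actSwap j u)
count0-actSwap (suc j) (suc x ∷ u) = count0-actSwap j u

Z≤count0 : ∀ xs ℓ → Z xs ℓ ≤ count0 xs
Z≤count0 []       ℓ = z≤n
Z≤count0 (x ∷ xs) ℓ with x ≡ᵇ ℓ
Z≤count0 (zero ∷ xs)  ℓ | true  = n≤1+n _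
Z≤count0 (suc x ∷ xs) ℓ | true  = ≤-refl
Z≤count0 (zero ∷ xs)  ℓ | false = m≤n⇒m≤1+n (Z≤count0 xs ℓ)
Z≤count0 (suc x ∷ xs) ℓ | false = Z≤count0 xs ℓ

Z-nonzero : ∀ xs ℓ → All (_≢ 0) xs → Z xs ℓ ≡ 0
Z-nonzero xs ℓ xs≢0 = n≤0⇒n≡0 (subst (Z xs ℓ ≤_) (count0-nonzero xs xs≢0) (Z≤count0 xs ℓ))

Z-insert : ∀ xs ys c ℓ → c ≢ 0 → c ≢ ℓ → Z (xs ++ c ∷ ys) ℓ ≡ Z (xs ++ ys) ℓ
Z-insert []       ys c ℓ _   c≢ℓ rewrite ≢⇒≡ᵇ-false c≢ℓ = refl
Z-insert (x ∷ xs) ys c ℓ c≢0 c≢ℓ with x ≡ᵇ ℓ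
... | true  = count0-insert xs ys c c≢0
... | false = Z-insert xs ys c ℓ c≢0 c≢ℓ

Z-insert-zero : ∀ xs ys ℓ → ℓ ∈ xs → Z (xs ++ 0 ∷ ys) ℓ ≡ suc (Z (xs ++ ys) ℓ)
Z-insert-zero (x ∷ xs) ys ℓ m with x ≟ ℓ
... | yes refl rewrite ≡ᵇ-refl x = count0-insert-zero xs ys
... | no x≢ℓ rewrite ≢⇒≡ᵇ-false x≢ℓ with m
...   | here ℓ≡x = ⊥-elim (x≢ℓ (sym ℓ≡x))
...   | there m′ = Z-insert-zero xs ys ℓ m′

Z-skip : ∀ xs ys ℓ → ℓ ∉ xs → Z (xs ++ ys) ℓ ≡ Z ys ℓ
Z-skip []       ys ℓ _  = refl
Z-skip (x ∷ xs) ys ℓ ℓ∉ rewrite ≢⇒≡ᵇ-false {x} {ℓ} (λ e → ℓ∉ (here (sym e))) = Z-skip xs ys ℓ (ℓ∉ ∘ there)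

Z-at : ∀ xs ys y → y ∉ xs → Z (xs ++ y ∷ ys) y ≡ count0 ys
Z-at xs ys y y∉ rewrite Z-skip xs (y ∷ ys) y y∉ | ≡ᵇ-refl y = refl

Z-actSwap : ∀ j u ℓ → Z u ℓ ≤ Z (actSwap (suc j) u) ℓ
Z-actSwap zero    []          ℓ = ≤-refl
Z-actSwap zero    (a ∷ [])    ℓ = ≤-refl
Z-actSwap zero    (a ∷ b ∷ u) ℓ with a <ᵇ b in eq
... | false = ≤-refl
... | true  = exchanged
  where
  a<b : a < b
  a<b = <ᵇ⇒< a b (subst T (sym eq) tt)
  count0-∷ : ∀ a → count0 u ≤ count0 (a ∷ u)
  count0-∷ zero    = n≤1+n _
  count0-∷ (suc a) = ≤-refl
  exchanged : Z (a ∷ b ∷ u) ℓ ≤ Z (b ∷ a ∷ u) ℓ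
  exchanged with a ≟ ℓ | b ≟ ℓ
  ... | yes refl | yes refl = ⊥-elim (<-irrefl refl a<b)
  ... | yes refl | no b≢a rewrite ≡ᵇ-refl a | ≢⇒≡ᵇ-false b≢a =
    ≤-reflexive (count0-insert [] u b (λ { refl → n≮0 a<b }))
  ... | no a≢ℓ | yes refl rewrite ≡ᵇ-refl b | ≢⇒≡ᵇ-false a≢ℓ = count0-∷ a
  ... | no a≢ℓ | no b≢ℓ rewrite ≢⇒≡ᵇ-false a≢ℓ | ≢⇒≡ᵇ-false b≢ℓ = ≤-refl
Z-actSwap (suc j) []      ℓ = ≤-refl
Z-actSwap (suc j) (x ∷ u) ℓ with x ≡ᵇ ℓ
... | true  = ≤-reflexive (sym (count0-actSwap j u))
... | false = Z-actSwap j u ℓ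

≤I-refl : ∀ u → u ≤I u
≤I-refl u = (λ ℓ s → s) , (λ b a i _ → i) , (λ ℓ _ → ≤-refl)

≤I-trans : ∀ {r v u} → r ≤I v → v ≤I u → r ≤I u
≤I-trans (supp₁ , inv₁ , zeros₁) (supp₂ , inv₂ , zeros₂) =
  (λ ℓ s → supp₂ ℓ (supp₁ ℓ s)) ,
  (λ b a i s → inv₁ b a (inv₂ b a i (supp₁ b s)) s) ,
  (λ ℓ s → ≤-trans (zeros₂ ℓ (supp₁ ℓ s)) (zeros₁ ℓ s))

≤I-act0 : ∀ u → Distinct u → act0 u ≤I u
≤I-act0 []       _             = ≤I-refl []
≤I-act0 (x ∷ xs) (x-fresh ∷ _) = supp , inv , zeros
  where
  fresh⇒≢ : ∀ {ℓ} → x ≡ 0 ⊎ x ∉ xs → ℓ ≢ 0 → ℓ ∈ xs → x ≢ ℓ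
  fresh⇒≢ (inj₁ x≡0) ℓ≢0 _  refl = ℓ≢0 x≡0
  fresh⇒≢ (inj₂ x∉) _    ℓ∈ refl = x∉ ℓ∈
  x≢ : ∀ {ℓ} → ℓ ≢ 0 → ℓ ∈ xs → x ≢ ℓ
  x≢ = fresh⇒≢ x-fresh
  supp : ∀ ℓ → InSupp ℓ (0 ∷ xs) → InSupp ℓ (x ∷ xs)
  supp ℓ (ℓ≢0 , here e)  = ⊥-elim (ℓ≢0 e)
  supp ℓ (ℓ≢0 , there m) = ℓ≢0 , there m
  inv : ∀ b a → Inv (x ∷ xs) b a → InSupp b (0 ∷ xs) → Inv (0 ∷ xs) b a
  inv b a _ (b≢0 , here e) = ⊥-elim (b≢0 e)
  inv b a i@(0<a , a<b , _) (b≢0 , there b∈) with Inv⇒Before i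
  ... | now _   = ⊥-elim (x≢ b≢0 b∈ refl)
  ... | later B = Before⇒Inv 0<a a<b (later B)
  zeros : ∀ ℓ → InSupp ℓ (0 ∷ xs) → Z (x ∷ xs) ℓ ≤ Z (0 ∷ xs) ℓ
  zeros ℓ (ℓ≢0 , here e) = ⊥-elim (ℓ≢0 e)
  zeros ℓ (ℓ≢0 , there m) rewrite ≢⇒≡ᵇ-false (x≢ ℓ≢0 m) | ≢⇒≡ᵇ-false {0} {ℓ} (ℓ≢0 ∘ sym) = ≤-refl

≤I-act₁ : ∀ u k → Distinct u → act₁ u k ≤I u
≤I-act₁ u zero    d = ≤I-act0 u d
≤I-act₁ u (suc j) _ =
  (λ ℓ (ℓ≢0 , m) → ℓ≢0 , ∈-actSwap⁻ u j m) ,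
  (λ b a i@(0<a , a<b , _) _ → Before⇒Inv 0<a a<b (Before-actSwap j u (Inv⇒Before i) a<b)) ,
  (λ ℓ _ → Z-actSwap j u ℓ)

≤I-actℕ : ∀ u w → Distinct u → actℕ u w ≤I u
≤I-actℕ u []      _ = ≤I-refl u
≤I-actℕ u (k ∷ w) d = ≤I-trans (≤I-actℕ (act₁ u k) w (Distinct-act₁ u k d)) (≤I-act₁ u k d)

Z-snoc : ∀ r y ℓ → y ≢ 0 → Z (r ++ y ∷ []) ℓ ≡ Z r ℓ
Z-snoc []      y ℓ _ with y ≡ᵇ ℓ
... | true  = refl
... | false = refl
Z-snoc (x ∷ r) y ℓ y≢0 with x ≡ᵇ ℓ
... | true  = trans (count0-insert r [] y y≢0) (cong count0 (++-identityʳ r))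
... | false = Z-snoc r y ℓ y≢0

Z-snoc-zero : ∀ r ℓ → ℓ ∈ r → Z (r ++ 0 ∷ []) ℓ ≡ suc (Z r ℓ)
Z-snoc-zero r ℓ ℓ∈ = trans (Z-insert-zero r [] ℓ ℓ∈) (cong (λ t → suc (Z t ℓ)) (++-identityʳ r))

-- Rooks below u in ≤I are reached from u

bubble-right-inside-bounded : ∀ {n} (A B : List ℕ) → length A + length B ≡ n → All (_< suc n) (map (length A +_) (asc 1 (length B)))
bubble-right-inside-bounded {n} A B A+B≡n = map⁺ (All.map bound (asc-inRange 1 (length B)))
  where
  bound : ∀ {x} → InRange 1 (length B) x → length A + x < suc n
  bound {x} (_ , x<1+B) = subst (length A + x <_) (trans (+-suc (length A) (length B)) (cong suc A+B≡n)) (+-monoʳ-< (length A) x<1+B)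

bubble-right-inside : ∀ A y B → All (y <_) B → actℕ (A ++ y ∷ B) (map (length A +_) (asc 1 (length B))) ≡ (A ++ B) ++ y ∷ []
bubble-right-inside A y B y<B = begin
  actℕ (A ++ y ∷ B) (map (length A +_) (asc 1 (length B)))  ≡⟨ actℕ-++ʳ A (y ∷ B) (asc 1 (length B)) (asc-positive (length B)) ⟩
  A ++ actℕ (y ∷ B) (asc 1 (length B))                      ≡⟨ cong (λ t → A ++ actℕ (y ∷ t) (asc 1 (length B))) (++-identityʳ B) ⟨
  A ++ actℕ (y ∷ B ++ []) (asc 1 (length B))                ≡⟨ cong (A ++_) (bubble-right y B [] y<B) ⟩
  A ++ B ++ y ∷ []                                          ≡⟨ ++-assoc A B (y ∷ []) ⟨
  (A ++ B) ++ y ∷ []                                        ∎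
  where open ≡-Reasoning

erase-to-end : ∀ A x B → All (_< x) A → All (0 <_) (A ++ B) →
  actℕ (A ++ x ∷ B) (desc 1 (length A) ++ 0 ∷ asc 1 (length (A ++ B))) ≡ (A ++ B) ++ 0 ∷ []
erase-to-end A x B A<x A++B>0 = begin
  actℕ (A ++ x ∷ B) (desc 1 (length A) ++ 0 ∷ asc 1 (length (A ++ B)))
    ≡⟨ actℕ-++ (A ++ x ∷ B) (desc 1 (length A)) _ ⟩
  actℕ (actℕ (A ++ x ∷ B) (desc 1 (length A))) (0 ∷ asc 1 (length (A ++ B)))
    ≡⟨ cong (λ t → actℕ t (0 ∷ asc 1 (length (A ++ B)))) (bubble-left A x B A<x) ⟩
  actℕ (0 ∷ A ++ B) (asc 1 (length (A ++ B)))
    ≡⟨ cong (λ t → actℕ (0 ∷ t) (asc 1 (length (A ++ B)))) (++-identityʳ (A ++ B)) ⟨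
  actℕ (0 ∷ (A ++ B) ++ []) (asc 1 (length (A ++ B)))
    ≡⟨ bubble-right 0 (A ++ B) [] A++B>0 ⟩
  (A ++ B) ++ 0 ∷ []
    ∎
  where open ≡-Reasoning

erase-to-end-bounded : ∀ {n} (A B : List ℕ) → length A + length B ≡ n →
  All (_< suc n) (desc 1 (length A) ++ 0 ∷ asc 1 (length (A ++ B)))
erase-to-end-bounded {n} A B A+B≡n =
  ++⁺ (All.map (λ { (_ , x<1+A) → ≤-trans x<1+A (s≤s A≤n) }) (desc-inRange 1 (length A)))
      (s≤s z≤n ∷ All.map (λ { {y} (_ , y<1+A+B) → subst (y <_) (cong suc A++B≡n) y<1+A+B }) (asc-inRange 1 (length (A ++ B))))
  where
  A≤n : length A ≤ n
  A≤n = subst (length A ≤_) A+B≡n (m≤m+n (length A) (length B))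
  A++B≡n : length (A ++ B) ≡ n
  A++B≡n = trans (length-++ A) A+B≡n

≤I-delete-last : ∀ A c B r y → (r ++ y ∷ []) ≤I (A ++ c ∷ B) →
  (∀ {ℓ} → ℓ ≢ 0 → ℓ ∈ r → ℓ ≢ c) → (∀ {a} → 0 < a → a ∈ A ++ B → a ≢ y) →
  (∀ ℓ → InSupp ℓ r → Z (A ++ B) ℓ ≤ Z r ℓ) → r ≤I (A ++ B)
≤I-delete-last A c B r y (supp , inv , _) ≢c ≢y zeros = supp′ , inv′ , zeros
  where
  supp′ : ∀ ℓ → InSupp ℓ r → InSupp ℓ (A ++ B)
  supp′ ℓ (ℓ≢0 , ℓ∈) = ℓ≢0 , ∈-delete A B (proj₂ (supp ℓ (ℓ≢0 , ∈-++⁺ˡ ℓ∈))) (≢c ℓ≢0 ℓ∈)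
  inv′ : ∀ b a → Inv (A ++ B) b a → InSupp b r → Inv r b a
  inv′ b a i@(0<a , a<b , _) (b≢0 , b∈) =
    Before⇒Inv 0<a a<b (Before-init r (Inv⇒Before (inv b a (Before⇒Inv 0<a a<b (Before-insert A B (Inv⇒Before i))) (b≢0 , ∈-++⁺ˡ b∈)))
                         (≢y 0<a (Before-∈ (Inv⇒Before i))))

Distinct-init : ∀ r {y} → Distinct (r ++ y ∷ []) → Distinct r
Distinct-init r d = subst Distinct (++-identityʳ r) (Distinct-delete r [] d)

Before-prefix : ∀ xs ys {a x} → a ∈ xs → Before (xs ++ x ∷ ys) a x
Before-prefix (y ∷ xs) ys (here refl) = now (∈-++⁺ʳ xs (here refl))
Before-prefix (y ∷ xs) ys (there m)   = later (Before-prefix xs ys m)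

first-∉ : ∀ (u r : List ℕ) → (∃ λ A → ∃₂ λ x B → u ≡ A ++ x ∷ B × x ∉ r × All (_∈ r) A) ⊎ All (_∈ r) u
first-∉ []      r = inj₂ []
first-∉ (x ∷ u) r with x ∈? r
... | no x∉r = inj₁ ([] , x , u , refl , x∉r , [])
... | yes x∈r with first-∉ u r
...   | inj₂ u⊆r = inj₂ (x∈r ∷ u⊆r)
...   | inj₁ (A , z , B , refl , z∉r , A⊆r) = inj₁ (x ∷ A , z , B , refl , z∉r , x∈r ∷ A⊆r)

⊆-missing-zero⇒length< : ∀ u r → Distinct u → All (_≢ 0) u → All (_∈ r) u → 0 ∈ r → length u < length r
⊆-missing-zero⇒length< []      (x ∷ r) _ _ _ _ = s≤s z≤n
⊆-missing-zero⇒length< (x ∷ u) r (x-fresh ∷ d) (x≢0 ∷ u≢0) (x∈r ∷ u⊆r) 0∈r with split-at-first x∈r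
... | r₁ , r₂ , refl , _ = subst (suc (length u) <_) (sym (length-insert r₁ r₂))
        (s≤s (⊆-missing-zero⇒length< u (r₁ ++ r₂) d u≢0
               (tabulate λ {y} y∈u → ∈-delete r₁ r₂ (All.lookup u⊆r y∈u) (λ { refl → x∉u y∈u }))
               (∈-delete r₁ r₂ 0∈r (x≢0 ∘ sym))))
  where
  x∉u : x ∉ u
  x∉u = fresh-nonzero x≢0 x-fresh

ReachedWithin : ℕ → List ℕ → List ℕ → Set
ReachedWithin n u r = ∃ λ w → All (_< n) w × actℕ u w ≡ r

Reach : ℕ → Set
Reach n = ∀ u r → length u ≡ n → length r ≡ n → Distinct u → Distinct r → r ≤I u → ReachedWithin n u r

extend-by-last : ∀ n → Reach n → ∀ u v y r w₁ → length v ≡ n → length r ≡ n →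
  actℕ u w₁ ≡ v ++ y ∷ [] → All (_< suc n) w₁ → Distinct v → Distinct r → r ≤I v →
  ReachedWithin (suc n) u (r ++ y ∷ [])
extend-by-last n reach u v y r w₁ lv lr u·w₁≡ w₁<n dv dr r≤v with reach v r lv lr dv dr r≤v
... | w₂ , w₂<n , v·w₂≡r = w₁ ++ w₂ , ++⁺ w₁<n (All.map m≤n⇒m≤1+n w₂<n) , (begin
  actℕ u (w₁ ++ w₂)               ≡⟨ actℕ-++ u w₁ w₂ ⟩
  actℕ (actℕ u w₁) w₂             ≡⟨ cong (λ t → actℕ t w₂) u·w₁≡ ⟩
  actℕ (v ++ y ∷ []) w₂           ≡⟨ actℕ-++ˡ v (y ∷ []) w₂ (subst (λ l → All (_< l) w₂) (sym lv) w₂<n) ⟩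
  actℕ v w₂ ++ y ∷ []             ≡⟨ cong (_++ y ∷ []) v·w₂≡r ⟩
  r ++ y ∷ []                     ∎)
  where open ≡-Reasoning

module _ (n : ℕ) (reach : Reach n) where

  -- The last letter y of r is moved to the end of u; no letter after y in u
  -- can be smaller than y, as it would be a zero counted by Z_u(y) or an
  -- inversion (y , c) of u missing from r.
  reach-nonzero-last : ∀ A y B r → length (A ++ y ∷ B) ≡ suc n → length (r ++ y ∷ []) ≡ suc n →
    Distinct (A ++ y ∷ B) → Distinct (r ++ y ∷ []) → (r ++ y ∷ []) ≤I (A ++ y ∷ B) → y ≢ 0 → y ∉ A →
    ReachedWithin (suc n) (A ++ y ∷ B) (r ++ y ∷ [])
  reach-nonzero-last A y B r lu lr du dr r≤u@(_ , inv , zeros) y≢0 y∉A =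
    extend-by-last n reach (A ++ y ∷ B) (A ++ B) y r (map (length A +_) (asc 1 (length B)))
      (trans (length-++ A) A+B≡n) (suc-injective (trans (sym (length-snoc r y)) lr))
      (bubble-right-inside A y B y<B) (bubble-right-inside-bounded A B A+B≡n) (Distinct-delete A B du) (Distinct-init r dr)
      (≤I-delete-last A y B r y r≤u (λ _ ℓ∈r ℓ≡y → y∉r (subst (_∈ r) ℓ≡y ℓ∈r)) (λ _ a∈ a≡y → y∉A++B (subst (_∈ A ++ B) a≡y a∈)) zeros′)
    where
    A+B≡n : length A + length B ≡ n
    A+B≡n = length-split A B lu
    y∉r : y ∉ r
    y∉r = Distinct-∉-before r [] dr y≢0
    y∉B : y ∉ B
    y∉B = Distinct-∉-after A B du y≢0
    y∉A++B : y ∉ A ++ B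
    y∉A++B m with ∈-++⁻ A m
    ... | inj₁ m′ = y∉A m′
    ... | inj₂ m′ = y∉B m′
    y-supp : InSupp y (r ++ y ∷ [])
    y-supp = y≢0 , ∈-++⁺ʳ r (here refl)
    y<B : All (y <_) B
    y<B = tabulate above
      where
      above : ∀ {c} → c ∈ B → y < c
      above {c} c∈B with <-cmp y c
      ... | tri< y<c _ _ = y<c
      ... | tri≈ _ refl _ = ⊥-elim (y∉B c∈B)
      ... | tri> _ _ c<y with c ≟ 0
      ...   | yes refl = ⊥-elim (1+n≰n (begin
                1                          ≤⟨ count0-positive B c∈B ⟩
                count0 B                   ≡⟨ Z-at A B y y∉A ⟨
                Z (A ++ y ∷ B) y           ≤⟨ zeros y y-supp ⟩
                Z (r ++ y ∷ []) y          ≡⟨ Z-at r [] y y∉r ⟩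
                0                          ∎))
        where open ≤-Reasoning
      ...   | no c≢0 = ⊥-elim (∉⇒¬Before-last r y∉r
                (Inv⇒Before (inv y c (Before⇒Inv (n≢0⇒n>0 c≢0) c<y (Before-split A B c∈B)) y-supp)))
    zeros′ : ∀ ℓ → InSupp ℓ r → Z (A ++ B) ℓ ≤ Z r ℓ
    zeros′ ℓ (ℓ≢0 , ℓ∈r) =
      subst₂ _≤_ (Z-insert A B y ℓ y≢0 (λ { refl → y∉r ℓ∈r })) (Z-snoc r y ℓ y≢0) (zeros ℓ (ℓ≢0 , ∈-++⁺ˡ ℓ∈r))

  reach-zero-last : ∀ A B r → length (A ++ 0 ∷ B) ≡ suc n → length (r ++ 0 ∷ []) ≡ suc n →
    Distinct (A ++ 0 ∷ B) → Distinct (r ++ 0 ∷ []) → (r ++ 0 ∷ []) ≤I (A ++ 0 ∷ B) → 0 ∉ B →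
    ReachedWithin (suc n) (A ++ 0 ∷ B) (r ++ 0 ∷ [])
  reach-zero-last A B r lu lr du dr r≤u@(_ , _ , zeros) 0∉B =
    extend-by-last n reach (A ++ 0 ∷ B) (A ++ B) 0 r (map (length A +_) (asc 1 (length B)))
      (trans (length-++ A) A+B≡n) (suc-injective (trans (sym (length-snoc r 0)) lr))
      (bubble-right-inside A 0 B (tabulate λ c∈B → n≢0⇒n>0 (All.lookup B≢0 c∈B))) (bubble-right-inside-bounded A B A+B≡n)
      (Distinct-delete A B du) (Distinct-init r dr)
      (≤I-delete-last A 0 B r 0 r≤u (λ ℓ≢0 _ → ℓ≢0) (λ 0<a _ a≡0 → <⇒≢ 0<a (sym a≡0)) zeros′)
    where
    A+B≡n : length A + length B ≡ n
    A+B≡n = length-split A B lu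
    B≢0 : All (_≢ 0) B
    B≢0 = tabulate λ c∈B c≡0 → 0∉B (subst (_∈ B) c≡0 c∈B)
    zeros′ : ∀ ℓ → InSupp ℓ r → Z (A ++ B) ℓ ≤ Z r ℓ
    zeros′ ℓ (ℓ≢0 , ℓ∈r) with ℓ ∈? A
    ... | yes ℓ∈A = s≤s⁻¹ (subst₂ _≤_ (Z-insert-zero A B ℓ ℓ∈A) (Z-snoc-zero r ℓ ℓ∈r) (zeros ℓ (ℓ≢0 , ∈-++⁺ˡ ℓ∈r)))
    ... | no ℓ∉A = ≤-trans (≤-reflexive (trans (Z-skip A B ℓ ℓ∉A) (Z-nonzero B ℓ B≢0))) z≤n

  -- With no zero in u, the first letter x of u missing from r exceeds every
  -- letter before it; it is moved to the front, erased, and the zero moved to the end.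
  reach-zero-last-erasing : ∀ u r → length u ≡ suc n → length (r ++ 0 ∷ []) ≡ suc n →
    Distinct u → Distinct (r ++ 0 ∷ []) → (r ++ 0 ∷ []) ≤I u → 0 ∉ u →
    ReachedWithin (suc n) u (r ++ 0 ∷ [])
  reach-zero-last-erasing u r lu lr du dr r≤u@(_ , inv , _) 0∉u with first-∉ u (r ++ 0 ∷ [])
  ... | inj₂ u⊆r = ⊥-elim (<-irrefl (trans lu (sym lr))
          (⊆-missing-zero⇒length< u (r ++ 0 ∷ []) du u≢0 u⊆r (∈-++⁺ʳ r (here refl))))
    where
    u≢0 : All (_≢ 0) u
    u≢0 = tabulate λ m e → 0∉u (subst (_∈ u) e m)
  ... | inj₁ (A , x , B , refl , x∉r , A⊆r) =
    extend-by-last n reach u (A ++ B) 0 r (desc 1 (length A) ++ 0 ∷ asc 1 (length (A ++ B)))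
      (trans (length-++ A) A+B≡n) (suc-injective (trans (sym (length-snoc r 0)) lr))
      (erase-to-end A x B A<x (All.map n≢0⇒n>0 A++B≢0)) (erase-to-end-bounded A B A+B≡n)
      (Distinct-delete A B du) (Distinct-init r dr)
      (≤I-delete-last A x B r 0 r≤u (λ _ ℓ∈r ℓ≡x → x∉r (∈-++⁺ˡ (subst (_∈ r) ℓ≡x ℓ∈r))) (λ 0<a _ a≡0 → <⇒≢ 0<a (sym a≡0))
        (λ ℓ _ → ≤-trans (≤-reflexive (Z-nonzero (A ++ B) ℓ A++B≢0)) z≤n))
    where
    u≢0 : All (_≢ 0) u
    u≢0 = tabulate λ m e → 0∉u (subst (_∈ u) e m)
    A+B≡n : length A + length B ≡ n
    A+B≡n = length-split A B lu
    x≢0 : x ≢ 0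
    x≢0 = All.lookup u≢0 (∈-++⁺ʳ A (here refl))
    A++B≢0 : All (_≢ 0) (A ++ B)
    A++B≢0 = tabulate λ m → All.lookup u≢0 (∈-insert A B m)
    A<x : All (_< x) A
    A<x = tabulate below
      where
      below : ∀ {a} → a ∈ A → a < x
      below {a} a∈A with <-cmp a x
      ... | tri< a<x _ _ = a<x
      ... | tri≈ _ refl _ = ⊥-elim (x∉r (All.lookup A⊆r a∈A))
      ... | tri> _ _ x<a = ⊥-elim (x∉r (Before-∈ (Inv⇒Before
              (inv a x (Before⇒Inv (n≢0⇒n>0 x≢0) x<a (Before-prefix A B a∈A)) (All.lookup u≢0 (∈-++⁺ˡ a∈A) , All.lookup A⊆r a∈A)))))

≤I⇒reachable : ∀ n → Reach n
≤I⇒reachable zero    []      []      _  _  _  _  _   = [] , [] , refl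
≤I⇒reachable (suc n) u r lu lr du dr r≤u with reverseView r
... | [] with lr
...   | ()
≤I⇒reachable (suc n) u r lu lr du dr r≤u | r′ ∶ _ ∶ʳ y with y ≟ 0
... | no y≢0 with split-at-first (proj₂ (proj₁ r≤u y (y≢0 , ∈-++⁺ʳ r′ (here refl))))
...   | A , B , refl , y∉A = reach-nonzero-last n (≤I⇒reachable n) A y B r′ lu lr du dr r≤u y≢0 y∉A
≤I⇒reachable (suc n) u r lu lr du dr r≤u | r′ ∶ _ ∶ʳ y | yes refl with 0 ∈? u
... | yes 0∈u with split-at-last 0∈u
...   | A , B , refl , 0∉B = reach-zero-last n (≤I⇒reachable n) A B r′ lu lr du dr r≤u 0∉B
≤I⇒reachable (suc n) u r lu lr du dr r≤u | r′ ∶ _ ∶ʳ y | yes refl | no 0∉u =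
  reach-zero-last-erasing n (≤I⇒reachable n) u r′ lu lr du dr r≤u 0∉u

LeqR⇒≤I : ∀ n (πr πu : List (Fin n)) → LeqR n πr πu → act (one n) πr ≤I act (one n) πu
LeqR⇒≤I n πr πu (m , πr≈πu·m) =
  subst (_≤I u) u·m≡r (≤I-actℕ u (map toℕ m) (distinct (Rook-act-one n πu)))
  where
  open ≡-Reasoning
  u = act (one n) πu
  u·m≡r : actℕ u (map toℕ m) ≡ act (one n) πr
  u·m≡r = begin
    actℕ u (map toℕ m)           ≡⟨ act≡actℕ u m ⟨
    act u m                      ≡⟨ act-++ (one n) πu m ⟨
    act (one n) (πu ++ m)        ≡⟨ act-respects-Cong (one n) πr≈πu·m ⟨
    act (one n) πr               ∎

≤I⇒LeqR : ∀ n (πr πu : List (Fin n)) → act (one n) πr ≤I act (one n) πu → LeqR n πr πu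
≤I⇒LeqR n πr πu r≤u with ≤I⇒reachable n (act (one n) πu) (act (one n) πr)
                          (length≡ (Rook-act-one n πu)) (length≡ (Rook-act-one n πr))
                          (distinct (Rook-act-one n πu)) (distinct (Rook-act-one n πr)) r≤u
... | w , w<n , u·w≡r = LeqR-of-actℕ n πr πu w w<n u·w≡r

theorem4p16 : (n : ℕ) (r u : List ℕ) → IsRook n r → IsRook n u →
    (πr πu : List (Fin n)) → act (one n) πr ≡ r → act (one n) πu ≡ u →
    LeqR n πr πu ⇔ (r ≤I u)
theorem4p16 n _ _ _ _ πr πu refl refl = mk⇔ (LeqR⇒≤I n πr πu) (≤I⇒LeqR n πr πu)
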